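{- Let $T$ be the set of natural numbers $n$ whose $\varphi$-representation has exactly one even exponent. Then the set of Zeckendorf representations of the elements of $T$ is accepted by a deterministic finite automaton (i.e. is a regular language). Furthermore, a natural number $n \ge 1$ lies in $T$ if and only if $n-1$ is a (possibly empty) sum of distinct odd-indexed Lucas numbers $L_{2i+1}$ with $i \ge 0$.
   Context: $\varphi = (1+\sqrt{5})/2$. Every real $x \ge 0$ has a unique $\varphi$-representation $x = \sum_{i \le t} e_i \varphi^i$ with $e_i \in \{0,1\}$, $e_i e_{i+1} = 0$ for all $i$, and no infinite tail $1010\cdots$; for natural numbers it is finite. The exponents of the representation are the $i$ with $e_i = 1$. Lucas numbers: $L_0 = 2$, $L_1 = 1$, $L_k = L_{k-1} + L_{k-2}$. The Zeckendorf representation of $n$ is the unique binary string $b_t \cdots b_2$ (no leading zero, no two adjacent $1$s) with $n = \sum_{i=2}^t b_i F_i$, where $F_i$ are the Fibonacci numbers ($F_0=0,F_1=1$). -}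

module Defs where

open import Data.Nat as ℕ using (ℕ; zero; suc)
open import Data.Integer as ℤ using (ℤ; +_; -[1+_]; ∣_∣)
open import Data.Bool using (Bool; true; false; if_then_else_)
open import Data.List using (List; []; _∷_; length; map)
open import Data.Product using (_×_; _,_; ∃-syntax)
open import Data.Unit using (⊤)
open import Data.Empty using (⊥)
open import Data.Fin using (Fin)
open import Relation.Binary.PropositionalEquality using (_≡_)

fib : ℕ → ℕ
fib 0 = 0
fib 1 = 1
fib (suc (suc n)) = fib (suc n) ℕ.+ fib n

lucas : ℕ → ℕ
lucas 0 = 2
lucas 1 = 1
lucas (suc (suc n)) = lucas (suc n) ℕ.+ lucas n

-- The ring ℤ[φ]: a pair (a , b) stands for a + b·φ, where φ² = φ + 1.
-- Since 1 and φ are linearly independent over ℚ, equality of real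
-- numbers a + bφ is exactly equality of the pairs.

ℤφ : Set
ℤφ = ℤ × ℤ

_+φ_ : ℤφ → ℤφ → ℤφ
(a , b) +φ (c , d) = (a ℤ.+ c , b ℤ.+ d)

-- multiplication by φ :  (a + bφ)φ = b + (a+b)φ
mulφ : ℤφ → ℤφ
mulφ (a , b) = (b , a ℤ.+ b)

-- multiplication by φ⁻¹ = φ - 1 :  (a + bφ)(φ - 1) = (b - a) + aφ
divφ : ℤφ → ℤφ
divφ (a , b) = (b ℤ.- a , a)

iter : (ℤφ → ℤφ) → ℕ → ℤφ → ℤφ
iter f zero x = x
iter f (suc k) x = f (iter f k x)

φ^ : ℤ → ℤφ
φ^ (+ n) = iter mulφ n (+ 1 , + 0)
φ^ -[1+ n ] = iter divφ (suc n) (+ 1 , + 0)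

φvalue : List ℤ → ℤφ
φvalue [] = (+ 0 , + 0)
φvalue (i ∷ es) = φ^ i +φ φvalue es

-- Exponent list written in strictly decreasing order with no two
-- consecutive integers (i.e. digits e_i ∈ {0,1} with e_i e_{i+1} = 0).
Gapped : List ℤ → Set
Gapped [] = ⊤
Gapped (x ∷ []) = ⊤
Gapped (x ∷ y ∷ r) = (y ℤ.+ + 2 ℤ.≤ x) × Gapped (y ∷ r)

-- es is (the list of exponents of) a φ-representation of n.
-- (Finite, so the "no infinite tail 1010…" condition is automatic.)
IsPhiRep : ℕ → List ℤ → Set
IsPhiRep n es = Gapped es × (φvalue es ≡ (+ n , + 0))

evenℕ : ℕ → Bool
evenℕ zero = true
evenℕ (suc zero) = false
evenℕ (suc (suc n)) = evenℕ n

evenℤ : ℤ → Bool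
evenℤ i = evenℕ ∣ i ∣

countEven : List ℤ → ℕ
countEven [] = 0
countEven (i ∷ es) = (if evenℤ i then 1 else 0) ℕ.+ countEven es

-- T: natural numbers whose φ-representation has exactly one even exponent
-- (the φ-representation is unique, so "some" = "the").
InT : ℕ → Set
InT n = ∃[ es ] (IsPhiRep n es × countEven es ≡ 1)

-- Zeckendorf representations: words b_t ⋯ b_2 over {0,1} (true = 1),
-- most significant digit first.

zval : List Bool → ℕ
zval [] = 0
zval (b ∷ w) = (if b then fib (length w ℕ.+ 2) else 0) ℕ.+ zval w

NoLeadingZero : List Bool → Set
NoLeadingZero [] = ⊤
NoLeadingZero (true ∷ _) = ⊤
NoLeadingZero (false ∷ _) = ⊥

NoAdjacentOnes : List Bool → Set
NoAdjacentOnes [] = ⊤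
NoAdjacentOnes (_ ∷ []) = ⊤
NoAdjacentOnes (true ∷ true ∷ _) = ⊥
NoAdjacentOnes (_ ∷ b ∷ w) = NoAdjacentOnes (b ∷ w)

IsZeckendorf : List Bool → ℕ → Set
IsZeckendorf w n = NoLeadingZero w × NoAdjacentOnes w × (zval w ≡ n)

record DFA : Set where
  field
    nStates   : ℕ
    start     : Fin nStates
    δ         : Fin nStates → Bool → Fin nStates
    accepting : Fin nStates → Bool

  run : Fin nStates → List Bool → Fin nStates
  run q [] = q
  run q (b ∷ w) = run (δ q b) w

  accepts : List Bool → Bool
  accepts w = accepting (run start w)

open DFA public using (accepts)

oddLucas : ℕ → ℕ
oddLucas i = lucas (suc (2 ℕ.* i))

-- Compute in ℤ[φ] = ℤ ⊕ ℤφ.  Since φ²ʲ⁺¹ − φ⁻⁽²ʲ⁺¹⁾ = L₂ⱼ₊₁ and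
-- 1 = φ⁻¹ + φ⁻³ + ⋯ + φ⁻⁽²ᵐ⁺¹⁾ + φ⁻⁽²ᵐ⁺²⁾, the number 1 + ∑_{j ∈ S} L₂ⱼ₊₁ with m = max S has the
-- φ-representation with exponents 2j+1 (j ∈ S), −(2j+1) (j < m, j ∉ S) and −(2m+2), whose only
-- even exponent is the last one.  Conversely, let a φ-representation of n have the single even
-- exponent e and the odd exponents 2j+1 (j ∈ P) and −(2j+1) (j ∈ N).  Its φ-coefficient
-- vanishes.  For e ≥ 0 this forces P = N = ∅ and e = 0, so n = 1.  For e = −(2m+2) it reads
-- ∑_P F₂ⱼ₊₁ + ∑_N F₂ⱼ₊₁ = F₂ₘ₊₂, an expansion with digits at most 2 which can only be
-- F₁ + F₃ + ⋯ + F₂ₘ₊₁; the integer part then gives n = 1 + ∑_{j ∈ P} L₂ⱼ₊₁.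
--
-- The automaton is the subset construction of a nondeterministic automaton that reads the
-- Zeckendorf word while guessing the odd-indexed Lucas numbers, and keeps the difference of the
-- two values in two integer carries.  Carries that leave a bounded region never return to an
-- accepting value, so only finitely many subsets occur, and the transition table between them
-- is checked by computation.

module Submission where

open import Defs
open import Data.Bool using (Bool; true; false; if_then_else_; not; T; T?; _∧_; _∨_)
open import Data.Bool.Properties using (T-∧; T-not-≡; ∧-zeroʳ; not-involutive)
import Data.Bool.Properties as Bool
open import Data.Empty using (⊥; ⊥-elim)
open import Data.Fin using (Fin)
import Data.Fin.Properties as Fin
open import Data.Integer as ℤ using (ℤ; +_; -[1+_])
import Data.Integer.Properties as ℤ
import Data.Integer.Tactic.RingSolver as ℤ-Solver
open import Data.List using (List; []; _∷_; map; length; _++_; mapMaybe; concatMap; filter; drop; lookup; foldr)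
open import Data.List.Membership.Propositional using (_∈_; _∉_; find; lose)
open import Data.List.Properties using (++-identityʳ; map-cong; map-∘)
open import Data.List.Relation.Unary.All as All using (All; []; _∷_)
import Data.List.Relation.Unary.All.Properties as All
open import Data.List.Relation.Unary.All.Properties using (++⁺; All¬⇒¬Any; ¬Any⇒All¬)
import Data.List.Relation.Unary.Any as Any
open import Data.List.Relation.Unary.Any using (here; there)
open import Data.List.Relation.Unary.AllPairs using ([]; _∷_)
open import Data.List.Relation.Unary.Unique.Propositional using (Unique)
import Data.List.Relation.Unary.Unique.Propositional.Properties as Unique
open import Data.Maybe using (Maybe; just; nothing)
open import Data.Nat as ℕ using (ℕ; zero; suc; _+_; _*_; _∸_; _≤_; _<_; _<?_; z≤n; s≤s; ⌊_/2⌋; ⌈_/2⌉)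
open import Data.Nat.ListAction using (sum)
open import Data.List.Membership.DecPropositional ℕ._≟_ using (_∈?_)
open import Data.Nat.Properties
open import Data.Nat.Tactic.RingSolver using (solve-∀)
open import Data.Product using (_×_; _,_; ∃-syntax; Σ; proj₁; proj₂)
open import Data.Product.Properties using (≡-dec)
open import Data.Sum using (_⊎_; inj₁; inj₂)
open import Data.Unit using (⊤; tt)
open import Function using (_∘_; id)
open import Function.Bundles using (_⇔_; mk⇔; Equivalence)
open import Relation.Binary.Definitions using (DecidableEquality; tri<; tri≈; tri>)
open import Relation.Binary.PropositionalEquality
open import Relation.Nullary using (¬_; Dec; yes; no; does; ¬?)
open import Relation.Nullary.Decidable using (_×-dec_; _⊎-dec_; map′; from-yes; dec-true; dec-false)
open import Relation.Unary using (Decidable)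

∑< : ℕ → (ℕ → ℕ) → ℕ
∑< zero    f = 0
∑< (suc n) f = ∑< n f + f n

infix 6.5 ∑<
syntax ∑< n (λ j → e) = ∑[ j < n ] e

∑-cong : ∀ n {f g : ℕ → ℕ} → (∀ {j} → j < n → f j ≡ g j) → ∑< n f ≡ ∑< n g
∑-cong zero    f≡g = refl
∑-cong (suc n) f≡g = cong₂ _+_ (∑-cong n (λ j<n → f≡g (m<n⇒m<1+n j<n))) (f≡g (n<1+n n))

∑-distrib-+ : ∀ n (f g : ℕ → ℕ) → ∑[ j < n ] (f j + g j) ≡ ∑< n f + ∑< n g
∑-distrib-+ zero    f g = refl
∑-distrib-+ (suc n) f g rewrite ∑-distrib-+ n f g = +-+-interchange (∑< n f) (∑< n g) (f n) (g n)
  where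
  +-+-interchange : ∀ a b c d → a + b + (c + d) ≡ a + c + (b + d)
  +-+-interchange = solve-∀

∑-*ˡ : ∀ n c (f : ℕ → ℕ) → ∑[ j < n ] (c * f j) ≡ c * ∑< n f
∑-*ˡ zero    c f = sym (*-zeroʳ c)
∑-*ˡ (suc n) c f rewrite ∑-*ˡ n c f = sym (*-distribˡ-+ c (∑< n f) (f n))

∑-mono-≤ : ∀ n {f g : ℕ → ℕ} → (∀ j → f j ≤ g j) → ∑< n f ≤ ∑< n g
∑-mono-≤ zero    f≤g = z≤n
∑-mono-≤ (suc n) f≤g = +-mono-≤ (∑-mono-≤ n f≤g) (f≤g n)

∑-zero : ∀ n → ∑[ j < n ] 0 ≡ 0
∑-zero zero    = refl
∑-zero (suc n) = trans (+-identityʳ _) (∑-zero n)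

𝟙 : Bool → ℕ
𝟙 true  = 1
𝟙 false = 0

𝟙≤1 : ∀ b → 𝟙 b ≤ 1
𝟙≤1 true  = ≤-refl
𝟙≤1 false = z≤n

if≡𝟙* : ∀ b x → (if b then x else 0) ≡ 𝟙 b * x
if≡𝟙* true  x = sym (+-identityʳ x)
if≡𝟙* false x = refl

infix 4 _∈ᵇ_
_∈ᵇ_ : ℕ → List ℕ → Bool
j ∈ᵇ S = does (j ∈? S)

∑-𝟙≡ : ∀ n (f : ℕ → ℕ) {a} → a < n → ∑[ j < n ] 𝟙 (does (j ℕ.≟ a)) * f j ≡ f a
∑-𝟙≡ (suc n) f {a} a<1+n with a ℕ.≟ n
... | no a≢n rewrite dec-false (n ℕ.≟ a) (a≢n ∘ sym) =
  trans (+-identityʳ _) (∑-𝟙≡ n f (≤∧≢⇒< (≤-pred a<1+n) a≢n))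
... | yes refl rewrite dec-true (a ℕ.≟ a) refl = begin
  ∑[ j < a ] 𝟙 (does (j ℕ.≟ a)) * f j + 1 * f a ≡⟨ cong (_+ 1 * f a) (trans (∑-cong a j<a⇒0) (∑-zero a)) ⟩
  0 + 1 * f a                                   ≡⟨ +-identityʳ (f a) ⟩
  f a                                           ∎
  where
  open ≡-Reasoning
  j<a⇒0 : ∀ {j} → j < a → 𝟙 (does (j ℕ.≟ a)) * f j ≡ 0
  j<a⇒0 {j} j<a rewrite dec-false (j ℕ.≟ a) (<⇒≢ j<a) = refl

𝟙-∈ᵇ-∷ : ∀ j {a S} → a ∉ S → 𝟙 (j ∈ᵇ a ∷ S) ≡ 𝟙 (does (j ℕ.≟ a)) + 𝟙 (j ∈ᵇ S)
𝟙-∈ᵇ-∷ j {a} {S} a∉S with j ℕ.≟ a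
... | no j≢a  rewrite dec-false (j ℕ.≟ a) j≢a = refl
... | yes refl rewrite dec-true (j ℕ.≟ j) refl | dec-false (j ∈? S) a∉S = refl

sum-map≡∑𝟙∈ᵇ : ∀ n (f : ℕ → ℕ) {S} → Unique S → All (_< n) S → sum (map f S) ≡ ∑[ j < n ] 𝟙 (j ∈ᵇ S) * f j
sum-map≡∑𝟙∈ᵇ n f {[]}    []           []         = sym (trans (∑-cong n (λ _ → refl)) (∑-zero n))
sum-map≡∑𝟙∈ᵇ n f {a ∷ S} (a∉S ∷ uniq) (a<n ∷ S<n) = begin
  f a + sum (map f S)
    ≡⟨ cong₂ _+_ (sym (∑-𝟙≡ n f a<n)) (sum-map≡∑𝟙∈ᵇ n f uniq S<n) ⟩
  ∑[ j < n ] 𝟙 (does (j ℕ.≟ a)) * f j + ∑[ j < n ] 𝟙 (j ∈ᵇ S) * f j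
    ≡⟨ sym (∑-distrib-+ n _ _) ⟩
  ∑[ j < n ] (𝟙 (does (j ℕ.≟ a)) * f j + 𝟙 (j ∈ᵇ S) * f j)
    ≡⟨ ∑-cong n (λ {j} _ → split j) ⟩
  ∑[ j < n ] 𝟙 (j ∈ᵇ a ∷ S) * f j
    ∎
  where
  open ≡-Reasoning
  split : ∀ j → 𝟙 (does (j ℕ.≟ a)) * f j + 𝟙 (j ∈ᵇ S) * f j ≡ 𝟙 (j ∈ᵇ a ∷ S) * f j
  split j = trans (sym (*-distribʳ-+ (f j) (𝟙 (does (j ℕ.≟ a))) (𝟙 (j ∈ᵇ S))))
                  (cong (_* f j) (sym (𝟙-∈ᵇ-∷ j (All¬⇒¬Any a∉S))))

sum-bounds : ∀ xs → All (_≤ sum xs) xs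
sum-bounds []       = []
sum-bounds (x ∷ xs) = m≤m+n x (sum xs) ∷ All.map (λ y≤ → ≤-trans y≤ (m≤n+m _ x)) (sum-bounds xs)

sum-map-+ : ∀ (f g : ℕ → ℕ) xs → sum (map (λ x → f x + g x) xs) ≡ sum (map f xs) + sum (map g xs)
sum-map-+ f g []       = refl
sum-map-+ f g (x ∷ xs) rewrite sum-map-+ f g xs = +-+-interchange (f x) (g x) (sum (map f xs)) (sum (map g xs))
  where
  +-+-interchange : ∀ a b c d → a + b + (c + d) ≡ a + c + (b + d)
  +-+-interchange = solve-∀

evenℕ-2* : ∀ j → evenℕ (2 * j) ≡ true
evenℕ-2* zero    = refl
evenℕ-2* (suc j) = trans (cong evenℕ (*-suc 2 j)) (evenℕ-2* j)

evenℕ-suc-2* : ∀ j → evenℕ (suc (2 * j)) ≡ false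
evenℕ-suc-2* zero    = refl
evenℕ-suc-2* (suc j) = trans (cong (evenℕ ∘ suc) (*-suc 2 j)) (evenℕ-suc-2* j)

evenℕ-suc : ∀ n → evenℕ (suc n) ≡ not (evenℕ n)
evenℕ-suc zero          = refl
evenℕ-suc (suc zero)    = refl
evenℕ-suc (suc (suc n)) = evenℕ-suc n

not-evenℕ-suc : ∀ n → not (evenℕ (suc n)) ≡ evenℕ n
not-evenℕ-suc n = trans (cong not (evenℕ-suc n)) (not-involutive (evenℕ n))

data Parity : ℕ → Set where
  even : ∀ k → Parity (2 * k)
  odd  : ∀ k → Parity (suc (2 * k))

parity : ∀ n → Parity n
parity zero = even 0
parity (suc n) with parity n
... | even k = odd k
... | odd k  = subst Parity (*-suc 2 k) (even (suc k))

⌊2*n/2⌋≡n : ∀ n → ⌊ 2 * n /2⌋ ≡ n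
⌊2*n/2⌋≡n zero    = refl
⌊2*n/2⌋≡n (suc n) = trans (cong ⌊_/2⌋ (*-suc 2 n)) (cong suc (⌊2*n/2⌋≡n n))

2*⌊n/2⌋≤n : ∀ n → 2 * ⌊ n /2⌋ ≤ n
2*⌊n/2⌋≤n n = begin
  2 * ⌊ n /2⌋              ≡⟨ cong (_+_ ⌊ n /2⌋) (+-identityʳ _) ⟩
  ⌊ n /2⌋ + ⌊ n /2⌋        ≤⟨ +-monoʳ-≤ ⌊ n /2⌋ (⌊n/2⌋≤⌈n/2⌉ n) ⟩
  ⌊ n /2⌋ + ⌈ n /2⌉        ≡⟨ ⌊n/2⌋+⌈n/2⌉≡n n ⟩
  n                        ∎
  where open ≤-Reasoning

even⇒2*⌊n/2⌋≡n : ∀ n → T (evenℕ n) → 2 * ⌊ n /2⌋ ≡ n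
even⇒2*⌊n/2⌋≡n n even-n with parity n
... | even k = cong (2 *_) (⌊2*n/2⌋≡n k)
... | odd k rewrite evenℕ-suc-2* k = ⊥-elim even-n

fib-suc>0 : ∀ n → 0 < fib (suc n)
fib-suc>0 zero    = s≤s z≤n
fib-suc>0 (suc n) = ≤-trans (fib-suc>0 n) (m≤m+n (fib (suc n)) (fib n))

fib-≤-suc : ∀ n → fib n ≤ fib (suc n)
fib-≤-suc zero    = z≤n
fib-≤-suc (suc n) = m≤m+n (fib (suc n)) (fib n)

fib-mono-≤ : ∀ {m n} → m ≤ n → fib m ≤ fib n
fib-mono-≤ {n = zero}  z≤n = z≤n
fib-mono-≤ {n = suc n} m≤1+n with m≤n⇒m<n∨m≡n m≤1+n
... | inj₁ (s≤s m≤n) = ≤-trans (fib-mono-≤ m≤n) (fib-≤-suc n)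
... | inj₂ refl      = ≤-refl

fib-2*-suc : ∀ n → fib (2 * suc n) ≡ fib (suc (2 * n)) + fib (2 * n)
fib-2*-suc n = cong fib (*-suc 2 n)

fib-suc-2*-suc : ∀ n → fib (suc (2 * suc n)) ≡ fib (2 * suc n) + fib (suc (2 * n))
fib-suc-2*-suc n = trans (cong (fib ∘ suc) (*-suc 2 n)) (cong (_+ fib (suc (2 * n))) (sym (fib-2*-suc n)))

fib-even<odd : ∀ n → fib (2 * n) < fib (suc (2 * n))
fib-even<odd zero    = s≤s z≤n
fib-even<odd (suc n) = begin-strict
  fib (2 * suc n)                          <⟨ m<m+n _ (fib-suc>0 (2 * n)) ⟩
  fib (2 * suc n) + fib (suc (2 * n))      ≡⟨ sym (fib-suc-2*-suc n) ⟩
  fib (suc (2 * suc n))                    ∎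
  where open ≤-Reasoning

2*fib-2*<fib-2*-suc : ∀ n → 2 * fib (2 * n) < fib (2 * suc n)
2*fib-2*<fib-2*-suc n = begin-strict
  2 * fib (2 * n)                   ≡⟨ cong (_+_ (fib (2 * n))) (+-identityʳ _) ⟩
  fib (2 * n) + fib (2 * n)         <⟨ +-monoʳ-< (fib (2 * n)) (fib-even<odd n) ⟩
  fib (2 * n) + fib (suc (2 * n))   ≡⟨ +-comm (fib (2 * n)) _ ⟩
  fib (suc (2 * n)) + fib (2 * n)   ≡⟨ sym (fib-2*-suc n) ⟩
  fib (2 * suc n)                   ∎
  where open ≤-Reasoning

lucas-suc : ∀ n → lucas (suc n) ≡ fib n + fib (suc (suc n))
lucas-suc zero          = refl
lucas-suc (suc zero)    = refl
lucas-suc (suc (suc n)) = trans (cong₂ _+_ (lucas-suc (suc n)) (lucas-suc n)) (regroup (fib n) (fib (suc n)))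
  where
  regroup : ∀ a b → b + (b + a + b) + (a + (b + a)) ≡ (b + a) + ((b + a + b) + (b + a))
  regroup = solve-∀

∑-fib-odd : ∀ m → ∑[ j < m ] fib (suc (2 * j)) ≡ fib (2 * m)
∑-fib-odd zero    = refl
∑-fib-odd (suc m) rewrite ∑-fib-odd m | fib-2*-suc m = +-comm (fib (2 * m)) (fib (suc (2 * m)))

ΣF₂ⱼ ΣF₂ⱼ₊₁ ΣF₂ⱼ₊₂ : List ℕ → ℕ
ΣF₂ⱼ   S = sum (map (λ j → fib (2 * j)) S)
ΣF₂ⱼ₊₁ S = sum (map (λ j → fib (suc (2 * j))) S)
ΣF₂ⱼ₊₂ S = sum (map (λ j → fib (suc (suc (2 * j)))) S)

ΣF₂ⱼ₊₁≡0⇒[] : ∀ P → ΣF₂ⱼ₊₁ P ≡ 0 → P ≡ []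
ΣF₂ⱼ₊₁≡0⇒[] []      _ = refl
ΣF₂ⱼ₊₁≡0⇒[] (j ∷ P) s≡0 = ⊥-elim (<⇒≢ (≤-trans (fib-suc>0 (2 * j)) (m≤m+n _ _)) (sym s≡0))

-- With digits c j ≤ 2, the only expansion of F₂ₘ by odd-indexed Fibonacci numbers is
-- F₁ + F₃ + ⋯ + F₂ₘ₋₁, as every top digit is forced; shifting each index by one then gives
-- F₂ + F₄ + ⋯ + F₂ₘ = F₂ₘ₊₁ − 1.
module OddFibonacciExpansion (c : ℕ → ℕ) (c≤2 : ∀ j → c j ≤ 2) where

  odd-sum even-sum : ℕ → ℕ
  odd-sum  B = ∑[ j < B ] c j * fib (suc (2 * j))
  even-sum B = ∑[ j < B ] c j * fib (suc (suc (2 * j)))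

  odd-sum-≤ : ∀ B → odd-sum B ≤ 2 * fib (2 * B)
  odd-sum-≤ B = begin
    odd-sum B                       ≤⟨ ∑-mono-≤ B (λ j → *-monoˡ-≤ (fib (suc (2 * j))) (c≤2 j)) ⟩
    ∑[ j < B ] 2 * fib (suc (2 * j)) ≡⟨ ∑-*ˡ B 2 _ ⟩
    2 * (∑[ j < B ] fib (suc (2 * j))) ≡⟨ cong (2 *_) (∑-fib-odd B) ⟩
    2 * fib (2 * B)                 ∎
    where open ≤-Reasoning

  digit-below : ∀ {B M} → M ≤ B → odd-sum (suc B) ≡ fib (2 * M) → c B ≡ 0
  digit-below {B} {M} M≤B eq with c B
  ... | zero  = refl
  ... | suc x = ⊥-elim (<⇒≱ (begin-strict
    fib (2 * M)                 <⟨ fib-even<odd M ⟩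
    fib (suc (2 * M))           ≤⟨ fib-mono-≤ (s≤s (*-monoʳ-≤ 2 M≤B)) ⟩
    fib (suc (2 * B))           ≤⟨ m≤m+n _ _ ⟩
    suc x * fib (suc (2 * B))   ≤⟨ m≤n+m _ (odd-sum B) ⟩
    odd-sum B + suc x * fib (suc (2 * B)) ∎) (≤-reflexive eq))
    where open ≤-Reasoning

  digit-top : ∀ {B} → odd-sum (suc B) ≡ fib (2 * suc B) → c B ≡ 1
  digit-top {B} eq with c B | c≤2 B
  ... | zero          | _ = ⊥-elim (<⇒≱ (≤-<-trans (odd-sum-≤ B) (2*fib-2*<fib-2*-suc B)) (≤-reflexive (trans (sym eq) (+-identityʳ _))))
  ... | suc zero      | _ = refl
  ... | suc (suc zero) | _ = ⊥-elim (<⇒≱ (begin-strict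
    fib (2 * suc B)                         ≡⟨ fib-2*-suc B ⟩
    fib (suc (2 * B)) + fib (2 * B)         <⟨ +-monoʳ-< (fib (suc (2 * B))) (fib-even<odd B) ⟩
    fib (suc (2 * B)) + fib (suc (2 * B))   ≡⟨ cong (_+_ (fib (suc (2 * B)))) (sym (+-identityʳ _)) ⟩
    2 * fib (suc (2 * B))                   ∎) (≤-trans (m≤n+m _ (odd-sum B)) (≤-reflexive eq)))
    where open ≤-Reasoning
  ... | suc (suc (suc _)) | s≤s (s≤s ())

  odd-sum-< : ∀ {B M} → suc B < M → odd-sum (suc B) < fib (2 * M)
  odd-sum-< {B} {M} B+1<M = begin-strict
    odd-sum (suc B)         ≤⟨ odd-sum-≤ (suc B) ⟩
    2 * fib (2 * suc B)     <⟨ 2*fib-2*<fib-2*-suc (suc B) ⟩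
    fib (2 * suc (suc B))   ≤⟨ fib-mono-≤ (*-monoʳ-≤ 2 B+1<M) ⟩
    fib (2 * M)             ∎
    where open ≤-Reasoning

  odd-sum≡⇒even-sum≡ : ∀ B M → odd-sum B ≡ fib (2 * M) → even-sum B + 1 ≡ fib (suc (2 * M))
  odd-sum≡⇒even-sum≡ zero zero    _   = refl
  odd-sum≡⇒even-sum≡ zero (suc M) 0≡F = ⊥-elim (<⇒≢ (subst (0 <_) (sym (fib-2*-suc M)) (fib-suc>0 (suc (2 * M)))) 0≡F)
  odd-sum≡⇒even-sum≡ (suc B) M eq with <-cmp M (suc B)
  ... | tri< (s≤s M≤B) _ _ = begin
    even-sum B + c B * F₂ᵦ₊₂ + 1         ≡⟨ cong (λ d → even-sum B + d * F₂ᵦ₊₂ + 1) (digit-below M≤B eq) ⟩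
    even-sum B + 0 + 1                   ≡⟨ cong (_+ 1) (+-identityʳ _) ⟩
    even-sum B + 1                       ≡⟨ odd-sum≡⇒even-sum≡ B M lower ⟩
    fib (suc (2 * M))                    ∎
    where
    open ≡-Reasoning
    F₂ᵦ₊₂ = fib (suc (suc (2 * B)))
    lower : odd-sum B ≡ fib (2 * M)
    lower = trans (sym (+-identityʳ _)) (trans (cong (λ d → odd-sum B + d * fib (suc (2 * B))) (sym (digit-below M≤B eq))) eq)
  ... | tri≈ _ refl _ = begin
    even-sum B + c B * F₂ᵦ₊₂ + 1         ≡⟨ cong (λ d → even-sum B + d * F₂ᵦ₊₂ + 1) (digit-top eq) ⟩
    even-sum B + (F₂ᵦ₊₂ + 0) + 1         ≡⟨ regroup (even-sum B) F₂ᵦ₊₂ ⟩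
    F₂ᵦ₊₂ + (even-sum B + 1)             ≡⟨ cong (_+_ F₂ᵦ₊₂) (odd-sum≡⇒even-sum≡ B B lower) ⟩
    fib (suc (suc (suc (2 * B))))        ≡⟨ cong (fib ∘ suc) (sym (*-suc 2 B)) ⟩
    fib (suc (2 * suc B))                ∎
    where
    open ≡-Reasoning
    F₂ᵦ₊₂ = fib (suc (suc (2 * B)))
    regroup : ∀ a f → a + (f + 0) + 1 ≡ f + (a + 1)
    regroup = solve-∀
    lower : odd-sum B ≡ fib (2 * B)
    lower = +-cancelʳ-≡ (fib (suc (2 * B))) _ _ (begin
      odd-sum B + fib (suc (2 * B))             ≡⟨ cong (_+_ (odd-sum B)) (sym (+-identityʳ _)) ⟩
      odd-sum B + 1 * fib (suc (2 * B))         ≡⟨ cong (λ d → odd-sum B + d * fib (suc (2 * B))) (sym (digit-top eq)) ⟩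
      odd-sum (suc B)                           ≡⟨ eq ⟩
      fib (2 * suc B)                           ≡⟨ fib-2*-suc B ⟩
      fib (suc (2 * B)) + fib (2 * B)           ≡⟨ +-comm (fib (suc (2 * B))) _ ⟩
      fib (2 * B) + fib (suc (2 * B))           ∎)
  ... | tri> _ _ B+1<M = ⊥-elim (<⇒≢ (odd-sum-< B+1<M) eq)

ΣF₂ⱼ₊₁≡F₂ₘ⇒ΣF₂ⱼ₊₂+1≡F₂ₘ₊₁ : ∀ {P N} → Unique P → Unique N → ∀ M →
  ΣF₂ⱼ₊₁ P + ΣF₂ⱼ₊₁ N ≡ fib (2 * M) →
  ΣF₂ⱼ₊₂ P + ΣF₂ⱼ₊₂ N + 1 ≡ fib (suc (2 * M))
ΣF₂ⱼ₊₁≡F₂ₘ⇒ΣF₂ⱼ₊₂+1≡F₂ₘ₊₁ {P} {N} unique-P unique-N M eq =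
  trans (cong (_+ 1) (as-∑ _)) (odd-sum≡⇒even-sum≡ B M (trans (sym (as-∑ _)) eq))
  where
  c : ℕ → ℕ
  c j = 𝟙 (j ∈ᵇ P) + 𝟙 (j ∈ᵇ N)
  open OddFibonacciExpansion c (λ j → +-mono-≤ (𝟙≤1 (j ∈ᵇ P)) (𝟙≤1 (j ∈ᵇ N)))
  B : ℕ
  B = suc (sum P + sum N)
  as-∑ : ∀ f → sum (map f P) + sum (map f N) ≡ ∑[ j < B ] c j * f j
  as-∑ f = begin
    sum (map f P) + sum (map f N)
      ≡⟨ cong₂ _+_ (sum-map≡∑𝟙∈ᵇ B f unique-P P<B) (sum-map≡∑𝟙∈ᵇ B f unique-N N<B) ⟩
    ∑[ j < B ] 𝟙 (j ∈ᵇ P) * f j + ∑[ j < B ] 𝟙 (j ∈ᵇ N) * f j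
      ≡⟨ sym (∑-distrib-+ B _ _) ⟩
    ∑[ j < B ] (𝟙 (j ∈ᵇ P) * f j + 𝟙 (j ∈ᵇ N) * f j)
      ≡⟨ ∑-cong B (λ {j} _ → sym (*-distribʳ-+ (f j) (𝟙 (j ∈ᵇ P)) _)) ⟩
    ∑[ j < B ] c j * f j
      ∎
    where
    open ≡-Reasoning
    P<B : All (_< B) P
    P<B = All.map (λ x≤ → s≤s (≤-trans x≤ (m≤m+n (sum P) (sum N)))) (sum-bounds P)
    N<B : All (_< B) N
    N<B = All.map (λ x≤ → s≤s (≤-trans x≤ (m≤n+m (sum N) (sum P)))) (sum-bounds N)

0φ : ℤφ
0φ = (+ 0 , + 0)

odd⁺ odd⁻ : ℕ → ℤ
odd⁺ j = + suc (2 * j)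
odd⁻ j = -[1+ 2 * j ]

oddPart⁺ oddPart⁻ : List ℕ → ℤφ
oddPart⁺ P = (+ ΣF₂ⱼ P , + ΣF₂ⱼ₊₁ P)
oddPart⁻ N = (ℤ.- + ΣF₂ⱼ₊₂ N , + ΣF₂ⱼ₊₁ N)

+φ-identityʳ : ∀ x → x +φ 0φ ≡ x
+φ-identityʳ (a , b) = cong₂ _,_ (ℤ.+-identityʳ a) (ℤ.+-identityʳ b)

+φ-assoc : ∀ x y z → (x +φ y) +φ z ≡ x +φ (y +φ z)
+φ-assoc (x₁ , x₂) (y₁ , y₂) (z₁ , z₂) = cong₂ _,_ (ℤ.+-assoc x₁ y₁ z₁) (ℤ.+-assoc x₂ y₂ z₂)

+φ-comm : ∀ x y → x +φ y ≡ y +φ x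
+φ-comm (x₁ , x₂) (y₁ , y₂) = cong₂ _,_ (ℤ.+-comm x₁ y₁) (ℤ.+-comm x₂ y₂)

+φ-left-comm : ∀ x y z → x +φ (y +φ z) ≡ y +φ (x +φ z)
+φ-left-comm x y z = trans (sym (+φ-assoc x y z)) (trans (cong (_+φ z) (+φ-comm x y)) (+φ-assoc y x z))

+φ-interchange : ∀ l x p n y → ((l +φ x) +φ p) +φ (n +φ y) ≡ l +φ (p +φ (n +φ (x +φ y)))
+φ-interchange (l₁ , l₂) (x₁ , x₂) (p₁ , p₂) (n₁ , n₂) (y₁ , y₂) =
  cong₂ _,_ (lemma l₁ x₁ p₁ n₁ y₁) (lemma l₂ x₂ p₂ n₂ y₂)
  where
  lemma : ∀ l x p n y → ((l ℤ.+ x) ℤ.+ p) ℤ.+ (n ℤ.+ y) ≡ l ℤ.+ (p ℤ.+ (n ℤ.+ (x ℤ.+ y)))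
  lemma = ℤ-Solver.solve-∀

+φ-reassoc : ∀ n x y → (n +φ (x +φ 0φ)) +φ y ≡ n +φ (x +φ y)
+φ-reassoc (n₁ , n₂) (x₁ , x₂) (y₁ , y₂) = cong₂ _,_ (lemma n₁ x₁ y₁) (lemma n₂ x₂ y₂)
  where
  lemma : ∀ n x y → (n ℤ.+ (x ℤ.+ + 0)) ℤ.+ y ≡ n ℤ.+ (x ℤ.+ y)
  lemma = ℤ-Solver.solve-∀

φvalue-++ : ∀ xs ys → φvalue (xs ++ ys) ≡ φvalue xs +φ φvalue ys
φvalue-++ []       ys = cong₂ _,_ (sym (ℤ.+-identityˡ _)) (sym (ℤ.+-identityˡ _))
φvalue-++ (x ∷ xs) ys = trans (cong (φ^ x +φ_) (φvalue-++ xs ys))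
  (cong₂ _,_ (sym (ℤ.+-assoc (proj₁ (φ^ x)) _ _)) (sym (ℤ.+-assoc (proj₂ (φ^ x)) _ _)))

φ^-+suc : ∀ k → φ^ (+ suc k) ≡ (+ fib k , + fib (suc k))
φ^-+suc zero    = refl
φ^-+suc (suc k) = trans (cong mulφ (φ^-+suc k)) (cong (λ x → (+ fib (suc k) , + x)) (+-comm (fib k) _))

φ^-+-im : ∀ k → proj₂ (φ^ (+ k)) ≡ + fib k
φ^-+-im zero    = refl
φ^-+-im (suc k) = cong proj₂ (φ^-+suc k)

φ^⁻ : ℕ → ℤφ
φ^⁻ n = iter divφ n (+ 1 , + 0)

mutual
  φ^⁻-even : ∀ j → φ^⁻ (2 * j) ≡ (+ fib (suc (2 * j)) , ℤ.- + fib (2 * j))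
  φ^⁻-even zero    = refl
  φ^⁻-even (suc j) = subst (λ n → φ^⁻ n ≡ (+ fib (suc n) , ℤ.- + fib n)) (sym (*-suc 2 j))
    (trans (cong divφ (φ^⁻-odd j)) (cong (_, ℤ.- + F₂) F₁+F₂))
    where
    F₁ = fib (suc (2 * j))
    F₂ = fib (suc (suc (2 * j)))
    F₁+F₂ : + F₁ ℤ.- ℤ.- + F₂ ≡ + (F₂ + F₁)
    F₁+F₂ = trans (cong (λ x → + F₁ ℤ.+ x) (ℤ.neg-involutive (+ F₂))) (cong +_ (+-comm F₁ F₂))

  φ^⁻-odd : ∀ j → φ^⁻ (suc (2 * j)) ≡ (ℤ.- + fib (suc (suc (2 * j))) , + fib (suc (2 * j)))
  φ^⁻-odd j = trans (cong divφ (φ^⁻-even j)) (cong (_, + fib (suc (2 * j))) (neg-sum (fib (2 * j)) (fib (suc (2 * j)))))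
    where
    neg-sum : ∀ a b → ℤ.- (+ a) ℤ.- + b ≡ ℤ.- + (b + a)
    neg-sum a b = trans (sym (ℤ.neg-distrib-+ (+ a) (+ b))) (cong (λ n → ℤ.- (+ n)) (+-comm a b))

φ^⁻-recurrence : ∀ n → φ^⁻ n ≡ φ^⁻ (suc n) +φ φ^⁻ (suc (suc n))
φ^⁻-recurrence n = divφ-recurrence (φ^⁻ n)
  where
  divφ-recurrence : ∀ x → x ≡ divφ x +φ divφ (divφ x)
  divφ-recurrence (a , b) = cong₂ _,_ (re a b) (im a b)
    where
    re : ∀ a b → a ≡ (b ℤ.- a) ℤ.+ (a ℤ.- (b ℤ.- a))
    re = ℤ-Solver.solve-∀
    im : ∀ a b → b ≡ a ℤ.+ (b ℤ.- a)
    im = ℤ-Solver.solve-∀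

φ^-oddLucas : ∀ j → φ^ (odd⁺ j) ≡ (+ oddLucas j , + 0) +φ φ^⁻ (suc (2 * j))
φ^-oddLucas j = begin
  φ^ (odd⁺ j)                                          ≡⟨ φ^-+suc (2 * j) ⟩
  (+ F₀ , + F₁)                                        ≡⟨ cong₂ _,_ (sym (cancel (+ F₀) (+ F₂))) refl ⟩
  (+ (F₀ + F₂) ℤ.+ ℤ.- + F₂ , + 0 ℤ.+ + F₁)
    ≡⟨ cong (λ L → (+ L , + 0) +φ (ℤ.- + F₂ , + F₁)) (sym (lucas-suc (2 * j))) ⟩
  (+ oddLucas j , + 0) +φ (ℤ.- + F₂ , + F₁)            ≡⟨ cong ((+ oddLucas j , + 0) +φ_) (sym (φ^⁻-odd j)) ⟩
  (+ oddLucas j , + 0) +φ φ^⁻ (suc (2 * j))            ∎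
  where
  open ≡-Reasoning
  F₀ = fib (2 * j)
  F₁ = fib (suc (2 * j))
  F₂ = fib (suc (suc (2 * j)))
  cancel : ∀ a b → a ℤ.+ b ℤ.+ ℤ.- b ≡ a
  cancel = ℤ-Solver.solve-∀

φvalue-map-odd⁺ : ∀ P → φvalue (map odd⁺ P) ≡ oddPart⁺ P
φvalue-map-odd⁺ []      = refl
φvalue-map-odd⁺ (j ∷ P) = cong₂ _+φ_ (φ^-+suc (2 * j)) (φvalue-map-odd⁺ P)

φvalue-map-odd⁻ : ∀ N → φvalue (map odd⁻ N) ≡ oddPart⁻ N
φvalue-map-odd⁻ []      = refl
φvalue-map-odd⁻ (j ∷ N) = trans (cong₂ _+φ_ (φ^⁻-odd j) (φvalue-map-odd⁻ N))
  (cong (_, + ΣF₂ⱼ₊₁ (j ∷ N)) (sym (ℤ.neg-distrib-+ (+ fib (suc (suc (2 * j)))) _)))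

odd⁺-+2 : ∀ k → odd⁺ k ℤ.+ + 2 ≡ odd⁺ (suc k)
odd⁺-+2 k = cong (+_ ∘ suc) (trans (+-comm (2 * k) 2) (sym (*-suc 2 k)))

odd⁻-+2 : ∀ k → odd⁻ (suc k) ℤ.+ + 2 ≡ odd⁻ k
odd⁻-+2 k = cong (λ n → -[1+ n ] ℤ.+ + 2) (*-suc 2 k)

+2≤odd⁺-suc : ∀ k {x} → x ℤ.+ + 2 ℤ.≤ odd⁺ k → x ℤ.+ + 2 ℤ.≤ odd⁺ (suc k)
+2≤odd⁺-suc k {x} x+2≤ = ℤ.≤-trans {x ℤ.+ + 2} x+2≤ (ℤ.≤-trans (ℤ.i≤i+j (odd⁺ k) (+ 2)) (ℤ.≤-reflexive (odd⁺-+2 k)))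

odd⁻-suc+2≤ : ∀ k {x} → odd⁻ k ℤ.+ + 2 ℤ.≤ x → odd⁻ (suc k) ℤ.+ + 2 ℤ.≤ x
odd⁻-suc+2≤ k ≤x = ℤ.≤-trans (ℤ.≤-reflexive (odd⁻-+2 k)) (ℤ.≤-trans (ℤ.i≤i+j (odd⁻ k) (+ 2)) ≤x)

Gapped-∷ : ∀ {x} xs → All (λ y → y ℤ.+ + 2 ℤ.≤ x) xs → Gapped xs → Gapped (x ∷ xs)
Gapped-∷ []      _           _  = _
Gapped-∷ (y ∷ _) (y+2≤x ∷ _) gs = y+2≤x , gs

Gapped-++ : ∀ {a} xs {ys} → Gapped xs → Gapped ys →
            All (a ℤ.≤_) xs → All (λ y → y ℤ.+ + 2 ℤ.≤ a) ys → Gapped (xs ++ ys)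
Gapped-++ []            _               gys _            _     = gys
Gapped-++ (x ∷ [])      _               gys (a≤x ∷ [])   ys≪a =
  Gapped-∷ _ (All.map (λ y+2≤a → ℤ.≤-trans y+2≤a a≤x) ys≪a) gys
Gapped-++ (x ∷ x' ∷ xs) (x'+2≤x , gxs) gys (_ ∷ a≤xs) ys≪a = x'+2≤x , Gapped-++ (x' ∷ xs) gxs gys a≤xs ys≪a

Gapped-descending : ∀ x es → Gapped (x ∷ es) → All (ℤ._< x) es
Gapped-descending x []       _ = []
Gapped-descending x (y ∷ es) (y+2≤x , gapped) =
  y<x ∷ All.map (λ z<y → ℤ.<-trans z<y y<x) (Gapped-descending y es gapped)
  where
  y<x : y ℤ.< x
  y<x = ℤ.<-≤-trans (subst (ℤ._< y ℤ.+ + 2) (ℤ.+-identityʳ y) (ℤ.+-monoʳ-< y (ℤ.+<+ (s≤s z≤n)))) y+2≤x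

Gapped⇒Unique : ∀ es → Gapped es → Unique es
Gapped⇒Unique []       _      = []
Gapped⇒Unique (x ∷ es) gapped =
  All.map (λ y<x x≡y → ℤ.<-irrefl (sym x≡y) y<x) (Gapped-descending x es gapped) ∷ Gapped⇒Unique es (Gapped-tail es gapped)
  where
  Gapped-tail : ∀ es → Gapped (x ∷ es) → Gapped es
  Gapped-tail []      _       = _
  Gapped-tail (_ ∷ _) (_ , g) = g

countEven-++ : ∀ xs ys → countEven (xs ++ ys) ≡ countEven xs + countEven ys
countEven-++ []       ys = refl
countEven-++ (x ∷ xs) ys =
  trans (cong (_+_ (if evenℤ x then 1 else 0)) (countEven-++ xs ys))
        (sym (+-assoc (if evenℤ x then 1 else 0) (countEven xs) (countEven ys)))

-- Every 1 + ∑_{j ∈ S} L₂ⱼ₊₁ lies in T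

module Representation (β : ℕ → Bool) where

  posExps negExps : ℕ → List ℤ
  posExps zero    = []
  posExps (suc k) = if β k then odd⁺ k ∷ posExps k else posExps k
  negExps zero    = []
  negExps (suc k) = negExps k ++ (if β k then [] else odd⁻ k ∷ [])

  oddLucasSum : ℕ → ℕ
  oddLucasSum k = ∑[ j < k ] 𝟙 (β j) * oddLucas j

  -- φ⁻²ᵏ = φ⁻⁽²ᵏ⁺¹⁾ + φ⁻⁽²ᵏ⁺²⁾ and φ²ᵏ⁺¹ = L₂ₖ₊₁ + φ⁻⁽²ᵏ⁺¹⁾: the exponent 2k+1 (if β k)
  -- or −(2k+1) (if not) joins the list as −2k is replaced by −(2k+2).
  φvalue-exps : ∀ k → φvalue (posExps k) +φ (φvalue (negExps k) +φ φ^⁻ (2 * k)) ≡ (+ suc (oddLucasSum k) , + 0)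
  φvalue-exps zero = refl
  φvalue-exps (suc k) with β k
  ... | true = begin
    (φ^ (odd⁺ k) +φ P) +φ (φvalue (negExps k ++ []) +φ φ^⁻ (2 * suc k))
      ≡⟨ cong₂ (λ x y → (x +φ P) +φ y) (φ^-oddLucas k)
               (cong₂ (λ ns n → φvalue ns +φ φ^⁻ n) (++-identityʳ (negExps k)) (*-suc 2 k)) ⟩
    ((L +φ φ^⁻ (suc (2 * k))) +φ P) +φ (N +φ φ^⁻ (suc (suc (2 * k))))
      ≡⟨ +φ-interchange L (φ^⁻ (suc (2 * k))) P N (φ^⁻ (suc (suc (2 * k)))) ⟩
    L +φ (P +φ (N +φ (φ^⁻ (suc (2 * k)) +φ φ^⁻ (suc (suc (2 * k))))))
      ≡⟨ cong (λ x → L +φ (P +φ (N +φ x))) (sym (φ^⁻-recurrence (2 * k))) ⟩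
    L +φ (P +φ (N +φ φ^⁻ (2 * k)))
      ≡⟨ cong (L +φ_) (φvalue-exps k) ⟩
    L +φ (+ suc (oddLucasSum k) , + 0)
      ≡⟨ cong (λ x → (+ x , + 0)) (+-comm (oddLucas k) (suc (oddLucasSum k))) ⟩
    (+ suc (oddLucasSum k + oddLucas k) , + 0)
      ≡⟨ cong (λ x → (+ suc (oddLucasSum k + x) , + 0)) (sym (*-identityˡ _)) ⟩
    (+ suc (oddLucasSum k + 1 * oddLucas k) , + 0) ∎
    where
    open ≡-Reasoning
    P = φvalue (posExps k)
    N = φvalue (negExps k)
    L = (+ oddLucas k , + 0)
  ... | false = begin
    P +φ (φvalue (negExps k ++ odd⁻ k ∷ []) +φ φ^⁻ (2 * suc k))
      ≡⟨ cong₂ (λ x n → P +φ (x +φ φ^⁻ n)) (φvalue-++ (negExps k) (odd⁻ k ∷ [])) (*-suc 2 k) ⟩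
    P +φ ((N +φ (φ^⁻ (suc (2 * k)) +φ 0φ)) +φ φ^⁻ (suc (suc (2 * k))))
      ≡⟨ cong (P +φ_) (+φ-reassoc N (φ^⁻ (suc (2 * k))) (φ^⁻ (suc (suc (2 * k))))) ⟩
    P +φ (N +φ (φ^⁻ (suc (2 * k)) +φ φ^⁻ (suc (suc (2 * k)))))
      ≡⟨ cong (λ x → P +φ (N +φ x)) (sym (φ^⁻-recurrence (2 * k))) ⟩
    P +φ (N +φ φ^⁻ (2 * k))
      ≡⟨ φvalue-exps k ⟩
    (+ suc (oddLucasSum k) , + 0)
      ≡⟨ cong (λ x → (+ suc x , + 0)) (sym (+-identityʳ _)) ⟩
    (+ suc (oddLucasSum k + 0) , + 0) ∎
    where
    open ≡-Reasoning
    P = φvalue (posExps k)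
    N = φvalue (negExps k)

  posExps-gapped : ∀ k → Gapped (posExps k) × All (λ x → x ℤ.+ + 2 ℤ.≤ odd⁺ k) (posExps k)
  posExps-gapped zero = _ , []
  posExps-gapped (suc k) with posExps-gapped k | β k
  ... | gapped , below | true  =
    Gapped-∷ (posExps k) below gapped , ℤ.≤-reflexive (odd⁺-+2 k) ∷ All.map (λ {x} → +2≤odd⁺-suc k {x}) below
  ... | gapped , below | false = gapped , All.map (λ {x} → +2≤odd⁺-suc k {x}) below

  posExps-positive : ∀ k → All (+ 1 ℤ.≤_) (posExps k)
  posExps-positive zero = []
  posExps-positive (suc k) with β k
  ... | true  = ℤ.+≤+ (s≤s z≤n) ∷ posExps-positive k
  ... | false = posExps-positive k

  negExps-gapped : ∀ k → Gapped (negExps k) × All (λ x → odd⁻ k ℤ.+ + 2 ℤ.≤ x) (negExps k)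
  negExps-gapped zero = _ , []
  negExps-gapped (suc k) with negExps-gapped k | β k
  ... | gapped , above | true  rewrite ++-identityʳ (negExps k) = gapped , All.map (λ {x} → odd⁻-suc+2≤ k {x}) above
  ... | gapped , above | false =
    Gapped-++ (negExps k) gapped _ above (ℤ.≤-refl ∷ []) ,
    ++⁺ (All.map (λ {x} → odd⁻-suc+2≤ k {x}) above) (ℤ.≤-reflexive (odd⁻-+2 k) ∷ [])

  negExps-negative : ∀ k → All (λ x → x ℤ.+ + 2 ℤ.≤ + 1) (negExps k)
  negExps-negative zero = []
  negExps-negative (suc k) = ++⁺ (negExps-negative k) (optional (β k))
    where
    optional : ∀ b → All (λ x → x ℤ.+ + 2 ℤ.≤ + 1) (if b then [] else odd⁻ k ∷ [])
    optional true  = []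
    optional false = ℤ.+-monoˡ-≤ (+ 2) { -[1+ 2 * k ]} { -[1+ 0 ]} (ℤ.-≤- z≤n) ∷ []

  posExps-countEven : ∀ k → countEven (posExps k) ≡ 0
  posExps-countEven zero = refl
  posExps-countEven (suc k) with β k
  ... | true rewrite evenℕ-suc-2* k = posExps-countEven k
  ... | false = posExps-countEven k

  negExps-countEven : ∀ k → countEven (negExps k) ≡ 0
  negExps-countEven zero = refl
  negExps-countEven (suc k) = trans (countEven-++ (negExps k) _) (cong₂ _+_ (negExps-countEven k) (optional (β k)))
    where
    optional : ∀ b → countEven (if b then [] else odd⁻ k ∷ []) ≡ 0
    optional true  = refl
    optional false rewrite evenℕ-suc-2* k = refl

  representation : ℕ → List ℤ
  representation m = posExps (suc m) ++ (negExps m ++ -[1+ suc (2 * m) ] ∷ [])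

  module _ {m} (βm : β m ≡ true) where

    representation-value : φvalue (representation m) ≡ (+ suc (oddLucasSum (suc m)) , + 0)
    representation-value = begin
      φvalue (representation m)
        ≡⟨ φvalue-++ (posExps (suc m)) _ ⟩
      φvalue (posExps (suc m)) +φ φvalue (negExps m ++ -[1+ suc (2 * m) ] ∷ [])
        ≡⟨ cong (φvalue (posExps (suc m)) +φ_) (φvalue-++ (negExps m) _) ⟩
      φvalue (posExps (suc m)) +φ (φvalue (negExps m) +φ (φ^⁻ (suc (suc (2 * m))) +φ 0φ))
        ≡⟨ cong (φvalue (posExps (suc m)) +φ_) (cong₂ (λ ns x → φvalue ns +φ x) negExps-suc (+φ-identityʳ _)) ⟩
      φvalue (posExps (suc m)) +φ (φvalue (negExps (suc m)) +φ φ^⁻ (suc (suc (2 * m))))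
        ≡⟨ cong (λ n → φvalue (posExps (suc m)) +φ (φvalue (negExps (suc m)) +φ φ^⁻ n)) (sym (*-suc 2 m)) ⟩
      φvalue (posExps (suc m)) +φ (φvalue (negExps (suc m)) +φ φ^⁻ (2 * suc m))
        ≡⟨ φvalue-exps (suc m) ⟩
      (+ suc (oddLucasSum (suc m)) , + 0) ∎
      where
      open ≡-Reasoning
      negExps-suc : negExps m ≡ negExps (suc m)
      negExps-suc = sym (trans (cong (λ b → negExps m ++ (if b then [] else odd⁻ m ∷ [])) βm) (++-identityʳ _))

    representation-gapped : Gapped (representation m)
    representation-gapped =
      Gapped-++ (posExps (suc m)) (proj₁ (posExps-gapped (suc m))) negative-part (posExps-positive (suc m))
        (++⁺ (negExps-negative m) (ℤ.+-monoˡ-≤ (+ 2) { -[1+ suc (2 * m) ]} { -[1+ 0 ]} (ℤ.-≤- z≤n) ∷ []))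
      where
      negative-part : Gapped (negExps m ++ -[1+ suc (2 * m) ] ∷ [])
      negative-part = Gapped-++ (negExps m) (proj₁ (negExps-gapped m)) _ (proj₂ (negExps-gapped m))
        (ℤ.+-monoˡ-≤ (+ 2) (ℤ.-≤- (n≤1+n (2 * m))) ∷ [])

    representation-countEven : countEven (representation m) ≡ 1
    representation-countEven = begin
      countEven (representation m)
        ≡⟨ countEven-++ (posExps (suc m)) _ ⟩
      countEven (posExps (suc m)) + countEven (negExps m ++ -[1+ suc (2 * m) ] ∷ [])
        ≡⟨ cong₂ _+_ (posExps-countEven (suc m)) (countEven-++ (negExps m) _) ⟩
      countEven (negExps m) + countEven (-[1+ suc (2 * m) ] ∷ [])
        ≡⟨ cong₂ _+_ (negExps-countEven m) (cong (λ b → (if b then 1 else 0) + 0) (evenℕ-2* m)) ⟩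
      1 ∎
      where open ≡-Reasoning

  representable : ∀ k → InT (suc (oddLucasSum k))
  representable zero = (+ 0 ∷ []) , (_ , refl) , refl
  representable (suc m) with β m in βm
  ... | true  = subst (λ b → InT (suc (oddLucasSum m + 𝟙 b * oddLucas m))) βm
    (representation m , (representation-gapped βm , representation-value βm) , representation-countEven βm)
  ... | false = subst (InT ∘ suc) (sym (+-identityʳ _)) (representable m)

InT-suc-sum-oddLucas : ∀ {S} → Unique S → InT (suc (sum (map oddLucas S)))
InT-suc-sum-oddLucas {S} unique =
  subst (InT ∘ suc) (sym (sum-map≡∑𝟙∈ᵇ (suc (sum S)) oddLucas unique (All.map s≤s (sum-bounds S)))) (representable (suc (sum S)))
  where open Representation (_∈ᵇ S)

-- Every element of T is 1 + ∑_{j ∈ S} L₂ⱼ₊₁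

data EvenExponent : ℤ → Set where
  pos-even : ∀ a → EvenExponent (+ (2 * a))
  neg-even : ∀ m → EvenExponent -[1+ suc (2 * m) ]

data Exponent : ℤ → Set where
  pos-odd  : ∀ j → Exponent (odd⁺ j)
  neg-odd  : ∀ j → Exponent (odd⁻ j)
  even-exp : ∀ {x} → EvenExponent x → Exponent x

exponent : ∀ x → Exponent x
exponent (+ n) with parity n
... | even a = even-exp (pos-even a)
... | odd j  = pos-odd j
exponent -[1+ n ] with parity n
... | even j = neg-odd j
... | odd m  = even-exp (neg-even m)

posOdds negOdds : List ℤ → List ℕ
posOdds [] = []
posOdds (x ∷ es) with exponent x
... | pos-odd j = j ∷ posOdds es
... | _         = posOdds es
negOdds [] = []
negOdds (x ∷ es) with exponent x
... | neg-odd j = j ∷ negOdds es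
... | _         = negOdds es

evens : List ℤ → List ℤ
evens [] = []
evens (x ∷ es) with exponent x
... | even-exp _ = x ∷ evens es
... | _          = evens es

evens-even : ∀ es → All EvenExponent (evens es)
evens-even [] = []
evens-even (x ∷ es) with exponent x
... | pos-odd _  = evens-even es
... | neg-odd _  = evens-even es
... | even-exp e = e ∷ evens-even es

private
  pos-value neg-value even-value : List ℤ → ℤφ
  pos-value  es = φvalue (map odd⁺ (posOdds es))
  neg-value  es = φvalue (map odd⁻ (negOdds es))
  even-value es = φvalue (evens es)

φvalue-split : ∀ es → φvalue es ≡ φvalue (map odd⁺ (posOdds es)) +φ (φvalue (map odd⁻ (negOdds es)) +φ φvalue (evens es))
φvalue-split [] = refl
φvalue-split (x ∷ es) with exponent x
... | pos-odd j  = trans (cong (φ^ x +φ_) (φvalue-split es)) (sym (+φ-assoc (φ^ x) (pos-value es) (neg-value es +φ even-value es)))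
... | neg-odd j  = trans (cong (φ^ x +φ_) (φvalue-split es))
  (trans (+φ-left-comm (φ^ x) (pos-value es) (neg-value es +φ even-value es))
         (cong (pos-value es +φ_) (sym (+φ-assoc (φ^ x) (neg-value es) (even-value es)))))
... | even-exp _ = trans (cong (φ^ x +φ_) (φvalue-split es))
  (trans (+φ-left-comm (φ^ x) (pos-value es) (neg-value es +φ even-value es))
         (cong (pos-value es +φ_) (+φ-left-comm (φ^ x) (neg-value es) (even-value es))))

countEven≡length-evens : ∀ es → countEven es ≡ length (evens es)
countEven≡length-evens [] = refl
countEven≡length-evens (x ∷ es) with exponent x
... | pos-odd j              rewrite evenℕ-suc-2* j = countEven≡length-evens es
... | neg-odd j              rewrite evenℕ-suc-2* j = countEven≡length-evens es
... | even-exp (pos-even a) rewrite evenℕ-2* a = cong suc (countEven≡length-evens es)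
... | even-exp (neg-even m) rewrite evenℕ-2* m = cong suc (countEven≡length-evens es)

posOdds-sound : ∀ es {j} → j ∈ posOdds es → odd⁺ j ∈ es
posOdds-sound (x ∷ es) j∈ with exponent x | j∈
... | pos-odd j  | here refl = here refl
... | pos-odd j  | there j∈' = there (posOdds-sound es j∈')
... | neg-odd _  | j∈'       = there (posOdds-sound es j∈')
... | even-exp _ | j∈'       = there (posOdds-sound es j∈')

negOdds-sound : ∀ es {j} → j ∈ negOdds es → odd⁻ j ∈ es
negOdds-sound (x ∷ es) j∈ with exponent x | j∈
... | neg-odd j  | here refl = here refl
... | neg-odd j  | there j∈' = there (negOdds-sound es j∈')
... | pos-odd _  | j∈'       = there (negOdds-sound es j∈')
... | even-exp _ | j∈'       = there (negOdds-sound es j∈')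

posOdds-unique : ∀ es → Unique es → Unique (posOdds es)
posOdds-unique []       []               = []
posOdds-unique (x ∷ es) (x∉es ∷ unique) with exponent x
... | pos-odd j  = ¬Any⇒All¬ _ (All¬⇒¬Any x∉es ∘ posOdds-sound es) ∷ posOdds-unique es unique
... | neg-odd _  = posOdds-unique es unique
... | even-exp _ = posOdds-unique es unique

negOdds-unique : ∀ es → Unique es → Unique (negOdds es)
negOdds-unique []       []               = []
negOdds-unique (x ∷ es) (x∉es ∷ unique) with exponent x
... | neg-odd j  = ¬Any⇒All¬ _ (All¬⇒¬Any x∉es ∘ negOdds-sound es) ∷ negOdds-unique es unique
... | pos-odd _  = negOdds-unique es unique
... | even-exp _ = negOdds-unique es unique

positive-even-exponent : ∀ {n} a P N → (+ n , + 0) ≡ oddPart⁺ P +φ (oddPart⁻ N +φ (φ^ (+ (2 * a)) +φ 0φ)) → n ≡ 1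
positive-even-exponent {n} a P N eq = from-φ-coefficient a P N φ-coefficient eq
  where
  φ-coefficient : 0 ≡ ΣF₂ⱼ₊₁ P + (ΣF₂ⱼ₊₁ N + (fib (2 * a) + 0))
  φ-coefficient = ℤ.+-injective
    (trans (cong proj₂ eq) (cong (λ x → + ΣF₂ⱼ₊₁ P ℤ.+ (+ ΣF₂ⱼ₊₁ N ℤ.+ (x ℤ.+ + 0))) (φ^-+-im (2 * a))))
  from-φ-coefficient : ∀ a P N → 0 ≡ ΣF₂ⱼ₊₁ P + (ΣF₂ⱼ₊₁ N + (fib (2 * a) + 0)) →
                       (+ n , + 0) ≡ oddPart⁺ P +φ (oddPart⁻ N +φ (φ^ (+ (2 * a)) +φ 0φ)) → n ≡ 1
  from-φ-coefficient (suc a) P N 0≡ _ =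
    ⊥-elim (<⇒≢ (≤-trans F>0 (≤-trans (m≤m+n _ 0) (≤-trans (m≤n+m _ (ΣF₂ⱼ₊₁ N)) (m≤n+m _ (ΣF₂ⱼ₊₁ P))))) 0≡)
    where
    F>0 : 0 < fib (2 * suc a)
    F>0 = subst (0 <_) (sym (cong fib (*-suc 2 a))) (fib-suc>0 (suc (2 * a)))
  from-φ-coefficient zero P N 0≡ eq
    with ΣF₂ⱼ₊₁≡0⇒[] P (m+n≡0⇒m≡0 (ΣF₂ⱼ₊₁ P) (sym 0≡))
       | ΣF₂ⱼ₊₁≡0⇒[] N (m+n≡0⇒m≡0 (ΣF₂ⱼ₊₁ N) (m+n≡0⇒n≡0 (ΣF₂ⱼ₊₁ P) (sym 0≡)))
  ... | refl | refl = ℤ.+-injective (cong proj₁ eq)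

negative-even-exponent : ∀ {n} m {P N} → Unique P → Unique N →
  (+ n , + 0) ≡ oddPart⁺ P +φ (oddPart⁻ N +φ (φ^ -[1+ suc (2 * m) ] +φ 0φ)) → n ≡ suc (sum (map oddLucas P))
negative-even-exponent {n} m {P} {N} unique-P unique-N eq = +-cancelʳ-≡ (ΣF₂ⱼ₊₂ N) n _ (begin
  n + ΣF₂ⱼ₊₂ N                                ≡⟨ integer-part ⟩
  ΣF₂ⱼ P + F′
    ≡⟨ cong (_+_ (ΣF₂ⱼ P)) (sym (ΣF₂ⱼ₊₁≡F₂ₘ⇒ΣF₂ⱼ₊₂+1≡F₂ₘ₊₁ unique-P unique-N (suc m) φ-coefficient)) ⟩
  ΣF₂ⱼ P + (ΣF₂ⱼ₊₂ P + ΣF₂ⱼ₊₂ N + 1)          ≡⟨ regroup (ΣF₂ⱼ P) (ΣF₂ⱼ₊₂ P) (ΣF₂ⱼ₊₂ N) ⟩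
  suc (ΣF₂ⱼ P + ΣF₂ⱼ₊₂ P) + ΣF₂ⱼ₊₂ N          ≡⟨ cong (λ x → suc x + ΣF₂ⱼ₊₂ N) (sym sum-oddLucas) ⟩
  suc (sum (map oddLucas P)) + ΣF₂ⱼ₊₂ N       ∎)
  where
  open ≡-Reasoning
  F F′ : ℕ
  F  = fib (2 * suc m)
  F′ = fib (suc (2 * suc m))
  eq′ : (+ n , + 0) ≡ oddPart⁺ P +φ (oddPart⁻ N +φ ((+ F′ , ℤ.- + F) +φ 0φ))
  eq′ = trans eq (cong (λ x → oddPart⁺ P +φ (oddPart⁻ N +φ (x +φ 0φ))) (trans (cong φ^⁻ (sym (*-suc 2 m))) (φ^⁻-even (suc m))))
  integer-part : n + ΣF₂ⱼ₊₂ N ≡ ΣF₂ⱼ P + F′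
  integer-part = ℤ.+-injective
    (trans (cong (ℤ._+ + ΣF₂ⱼ₊₂ N) (cong proj₁ eq′)) (lemma (+ ΣF₂ⱼ P) (+ ΣF₂ⱼ₊₂ N) (+ F′)))
    where
    lemma : ∀ a b c → a ℤ.+ (ℤ.- b ℤ.+ (c ℤ.+ + 0)) ℤ.+ b ≡ a ℤ.+ c
    lemma = ℤ-Solver.solve-∀
  φ-coefficient : ΣF₂ⱼ₊₁ P + ΣF₂ⱼ₊₁ N ≡ F
  φ-coefficient = ℤ.+-injective
    (trans (sym (lemma (+ ΣF₂ⱼ₊₁ P) (+ ΣF₂ⱼ₊₁ N) (+ F))) (cong (ℤ._+ + F) (sym (cong proj₂ eq′))))
    where
    lemma : ∀ a b c → a ℤ.+ (b ℤ.+ (ℤ.- c ℤ.+ + 0)) ℤ.+ c ≡ a ℤ.+ b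
    lemma = ℤ-Solver.solve-∀
  regroup : ∀ a b c → a + (b + c + 1) ≡ suc (a + b) + c
  regroup = solve-∀
  sum-oddLucas : sum (map oddLucas P) ≡ ΣF₂ⱼ P + ΣF₂ⱼ₊₂ P
  sum-oddLucas = trans (cong sum (map-cong (λ j → lucas-suc (2 * j)) P)) (sum-map-+ (λ j → fib (2 * j)) (λ j → fib (suc (suc (2 * j)))) P)

InT⇒suc-sum-oddLucas : ∀ {n} → InT n → ∃[ S ] (Unique S × n ≡ suc (sum (map oddLucas S)))
InT⇒suc-sum-oddLucas {n} (es , (gapped , value) , one-even) =
  from-evens (evens es) (evens-even es) (trans (sym (countEven≡length-evens es)) one-even) split
  where
  P N : List ℕ
  P = posOdds es
  N = negOdds es
  unique-P : Unique P
  unique-P = posOdds-unique es (Gapped⇒Unique es gapped)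
  unique-N : Unique N
  unique-N = negOdds-unique es (Gapped⇒Unique es gapped)
  split : (+ n , + 0) ≡ oddPart⁺ P +φ (oddPart⁻ N +φ φvalue (evens es))
  split = trans (sym value) (trans (φvalue-split es)
    (cong₂ (λ p q → p +φ (q +φ φvalue (evens es))) (φvalue-map-odd⁺ P) (φvalue-map-odd⁻ N)))
  from-evens : ∀ E → All EvenExponent E → length E ≡ 1 → (+ n , + 0) ≡ oddPart⁺ P +φ (oddPart⁻ N +φ φvalue E) →
               ∃[ S ] (Unique S × n ≡ suc (sum (map oddLucas S)))
  from-evens (_ ∷ []) (pos-even a ∷ []) refl eq = [] , [] , positive-even-exponent a P N eq
  from-evens (_ ∷ []) (neg-even m ∷ []) refl eq = P , unique-P , negative-even-exponent m unique-P unique-N eq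

InT⇔oddLucas : ∀ n → InT (suc n) ⇔ (∃[ S ] (Unique S × n ≡ sum (map oddLucas S)))
InT⇔oddLucas n = mk⇔
  (λ inT → let (S , unique , eq) = InT⇒suc-sum-oddLucas inT in S , unique , suc-injective eq)
  (λ (S , unique , eq) → subst (InT ∘ suc) (sym eq) (InT-suc-sum-oddLucas unique))

-- Determinising an automaton that guesses a second word

module _ {A B : Set} (f : A → Maybe B) where

  ∈-mapMaybe⁺ : ∀ {x y xs} → x ∈ xs → f x ≡ just y → y ∈ mapMaybe f xs
  ∈-mapMaybe⁺ {xs = x ∷ xs} (here refl) fx≡y rewrite fx≡y = here refl
  ∈-mapMaybe⁺ {xs = x ∷ xs} (there x∈xs) fx≡y with f x
  ... | just _  = there (∈-mapMaybe⁺ x∈xs fx≡y)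
  ... | nothing = ∈-mapMaybe⁺ x∈xs fx≡y

  ∈-mapMaybe⁻ : ∀ xs {y} → y ∈ mapMaybe f xs → ∃[ x ] (x ∈ xs × f x ≡ just y)
  ∈-mapMaybe⁻ (x ∷ xs) y∈ with f x in fx
  ∈-mapMaybe⁻ (x ∷ xs) (here refl) | just _ = x , here refl , fx
  ∈-mapMaybe⁻ (x ∷ xs) (there y∈) | just _ = let (x' , x'∈ , fx') = ∈-mapMaybe⁻ xs y∈ in x' , there x'∈ , fx'
  ∈-mapMaybe⁻ (x ∷ xs) y∈         | nothing = let (x' , x'∈ , fx') = ∈-mapMaybe⁻ xs y∈ in x' , there x'∈ , fx'

data Run {C : Set} (step : C → Bool → Bool → Maybe C) : C → List Bool → List Bool → C → Set where
  []  : ∀ {c} → Run step c [] [] c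
  _∷_ : ∀ {c b s c₁ w ss c'} → step c b s ≡ just c₁ → Run step c₁ w ss c' → Run step c (b ∷ w) (s ∷ ss) c'

module Determinisation
  {C : Set} (_≟_ : DecidableEquality C) (step : C → Bool → Bool → Maybe C)
  {Dead : C → Set} (dead? : Decidable Dead) (dead-step : ∀ {c b s c'} → Dead c → step c b s ≡ just c' → Dead c')
  {Accepting : C → Set} (accepting? : Decidable Accepting) (dead⇒rejecting : ∀ {c} → Dead c → ¬ Accepting c)
  where

  open import Data.List.Membership.DecPropositional _≟_ using () renaming (_∈?_ to _∈ᶜ?_)
  open import Data.List.Relation.Binary.Subset.DecPropositional _≟_ using (_⊆?_)

  successors : C → Bool → List C
  successors c b = mapMaybe (step c b) (false ∷ true ∷ [])

  ∈-successors⁺ : ∀ {c b s c'} → step c b s ≡ just c' → c' ∈ successors c b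
  ∈-successors⁺ {c} {b} {false} = ∈-mapMaybe⁺ (step c b) {xs = false ∷ true ∷ []} (here refl)
  ∈-successors⁺ {c} {b} {true}  = ∈-mapMaybe⁺ (step c b) {xs = false ∷ true ∷ []} (there (here refl))

  ∈-successors⁻ : ∀ {c b c'} → c' ∈ successors c b → ∃[ s ] step c b s ≡ just c'
  ∈-successors⁻ {c} {b} c'∈ = let (s , _ , eq) = ∈-mapMaybe⁻ (step c b) (false ∷ true ∷ []) c'∈ in s , eq

  dead-run : ∀ {c w ss c'} → Dead c → Run step c w ss c' → Dead c'
  dead-run dead []         = dead
  dead-run dead (st ∷ run) = dead-run (dead-step dead st) run

  -- Candidate subsets, found by exploring from a start set; Table.certified? checks them.
  image : List C → Bool → List C
  image X b = filter (¬? ∘ dead?) (concatMap (λ c → successors c b) X)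

  _≈ᵇ_ : List C → List C → Bool
  X ≈ᵇ Y = does (X ⊆? Y) ∧ does (Y ⊆? X)

  insert : List C → List (List C) → List (List C)
  insert X []       = X ∷ []
  insert X (Y ∷ Ys) = if X ≈ᵇ Y then Y ∷ Ys else Y ∷ insert X Ys

  explore : ℕ → List (List C) → List (List C)
  explore zero    Xs = Xs
  explore (suc n) Xs = explore n (foldr insert Xs (concatMap (λ X → image X false ∷ image X true ∷ []) Xs))

  module Table (start : List C) (others : List (List C)) where

    table : List (List C)
    table = start ∷ others

    sub : Fin (length table) → List C
    sub = lookup table

    locate : List C → (Y : List C) (Ys : List (List C)) → Fin (length (Y ∷ Ys))
    locate X Y []       = Fin.zero
    locate X Y (Z ∷ Zs) = if X ≈ᵇ Y then Fin.zero else Fin.suc (locate X Z Zs)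

    dfa : DFA
    dfa = record
      { nStates   = length table
      ; start     = Fin.zero
      ; δ         = λ q b → locate (image (sub q) b) start others
      ; accepting = λ q → does (Any.any? accepting? (sub q))
      }

    open DFA dfa using (δ; run)

    Forward Backward : Fin (length table) → Bool → Set
    Forward  q b = All (λ c → All (λ c' → Dead c' ⊎ c' ∈ sub (δ q b)) (successors c b)) (sub q)
    Backward q b = All (λ c' → Any.Any (λ c → c' ∈ successors c b) (sub q)) (sub (δ q b))

    Certified : Set
    Certified = ∀ q → (Forward q false × Forward q true) × (Backward q false × Backward q true)

    certified? : Dec Certified
    certified? = Fin.all? λ q → (forward? q false ×-dec forward? q true) ×-dec (backward? q false ×-dec backward? q true)
      where
      forward? : ∀ q b → Dec (Forward q b)
      backward? : ∀ q b → Dec (Backward q b)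
      forward? q b = All.all? (λ c → All.all? (λ c' → dead? c' ⊎-dec (c' ∈ᶜ? sub (δ q b))) (successors c b)) (sub q)
      backward? q b = All.all? (λ c' → Any.any? (λ c → c' ∈ᶜ? successors c b) (sub q)) (sub (δ q b))

    module _ (certified : Certified) where

      forward : ∀ q b → Forward q b
      forward q false = proj₁ (proj₁ (certified q))
      forward q true  = proj₂ (proj₁ (certified q))

      backward : ∀ q b → Backward q b
      backward q false = proj₁ (proj₂ (certified q))
      backward q true  = proj₂ (proj₂ (certified q))

      run-forward : ∀ {q c w ss c'} → c ∈ sub q → Run step c w ss c' → Dead c' ⊎ c' ∈ sub (run q w)
      run-forward c∈q []                          = inj₂ c∈q
      run-forward {q} {c} {b ∷ _} c∈q (st ∷ rest) with All.lookup (All.lookup (forward q b) c∈q) (∈-successors⁺ st)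
      ... | inj₁ dead = inj₁ (dead-run dead rest)
      ... | inj₂ c₁∈  = run-forward c₁∈ rest

      run-backward : ∀ {q} w {c'} → c' ∈ sub (run q w) → ∃[ c ] ∃[ ss ] (c ∈ sub q × Run step c w ss c')
      run-backward []                {c'} c'∈ = c' , [] , c'∈ , []
      run-backward {q} (b ∷ w) c'∈ with run-backward w c'∈
      ... | c₁ , ss , c₁∈ , rest with find (All.lookup (backward q b) c₁∈)
      ...   | c , c∈q , c₁∈succ with ∈-successors⁻ c₁∈succ
      ...     | s , st = c , s ∷ ss , c∈q , st ∷ rest

      accepts⇔ : ∀ w → accepts dfa w ≡ true ⇔ (∃[ c ] ∃[ ss ] ∃[ c' ] (c ∈ start × Run step c w ss c' × Accepting c'))
      accepts⇔ w = mk⇔ to from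
        where
        to : accepts dfa w ≡ true → ∃[ c ] ∃[ ss ] ∃[ c' ] (c ∈ start × Run step c w ss c' × Accepting c')
        to acc with Any.any? accepting? (sub (run Fin.zero w))
        to _  | yes some-accepting =
          let (c' , c'∈ , accepting) = find some-accepting
              (c , ss , c∈ , r) = run-backward w c'∈
          in c , ss , c' , c∈ , r , accepting
        to () | no _
        from : ∃[ c ] ∃[ ss ] ∃[ c' ] (c ∈ start × Run step c w ss c' × Accepting c') → accepts dfa w ≡ true
        from (c , ss , c' , c∈ , r , accepting) with run-forward {Fin.zero} c∈ r
        ... | inj₁ dead = ⊥-elim (dead⇒rejecting dead accepting)
        ... | inj₂ c'∈  = dec-true (Any.any? accepting? (sub (run Fin.zero w))) (lose c'∈ accepting)

-- An automaton reading a Zeckendorf word and guessing a word of Lucas digits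

lucasValue : List Bool → ℕ
lucasValue []       = 0
lucasValue (s ∷ ss) = (if s then lucas (suc (length ss)) else 0) + lucasValue ss

EvenOnly : List Bool → Set
EvenOnly []       = ⊤
EvenOnly (s ∷ ss) = (T s → T (evenℕ (length ss))) × EvenOnly ss

-- Reading w while guessing ss, the quantity u Fₖ₊₂ + v Fₖ₊₁ + zval w' − lucasValue ss' is
-- invariant, where w', ss' are the unread suffixes and k their length.  evenRest guesses
-- the parity of k; lastOne and started enforce the Zeckendorf conditions.
record Config : Set where
  constructor config
  field
    u v                      : ℤ
    evenRest lastOne started : Bool

open Config

bit : Bool → ℤ
bit b = + 𝟙 b

allowed : Config → Bool → Bool → Bool
allowed c b s = (started c ∨ b) ∧ not (lastOne c ∧ b) ∧ not (evenRest c ∧ s)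

advance : Config → Bool → Bool → Config
advance (config u v e _ _) b s = config (u ℤ.+ v ℤ.+ bit b ℤ.- bit s ℤ.- bit s) (u ℤ.+ bit s) (not e) b true

step : Config → Bool → Bool → Maybe Config
step c b s = if allowed c b s then just (advance c b s) else nothing

initial : Bool → Config
initial p = config (+ 0) (+ 0) p false false

Accepting : Config → Set
Accepting c = T (evenRest c) × u c ℤ.+ v c ≡ + 1

-- Discarding dead configurations keeps the subset construction finite.
Dead : Config → Set
Dead c = (+ 1 ℤ.≤ u c × + 3 ℤ.≤ u c ℤ.+ v c) ⊎ (u c ℤ.≤ -[1+ 0 ] × u c ℤ.+ v c ℤ.≤ -[1+ 1 ])

step-just : ∀ c b s {c'} → step c b s ≡ just c' → T (allowed c b s) × advance c b s ≡ c'
step-just c b s eq with allowed c b s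
step-just c b s refl | true  = tt , refl
step-just c b s ()   | false

step-allowed : ∀ {c b s} → T (allowed c b s) → step c b s ≡ just (advance c b s)
step-allowed {c} {b} {s} ok with allowed c b s
... | true  = refl
... | false = ⊥-elim ok

run-length : ∀ {c w ss c'} → Run step c w ss c' → length ss ≡ length w
run-length []         = refl
run-length (_ ∷ rest) = cong suc (run-length rest)

bit-* : ∀ b x → + (if b then x else 0) ≡ bit b ℤ.* + x
bit-* true  x = sym (ℤ.*-identityˡ (+ x))
bit-* false x = refl

run-value : ∀ {c w ss c'} → Run step c w ss c' →
  u c' ℤ.+ v c' ≡ u c ℤ.* + fib (suc (suc (length w))) ℤ.+ v c ℤ.* + fib (suc (length w)) ℤ.+ (+ zval w ℤ.- + lucasValue ss)
run-value {config u v _ _ _} [] = lemma u v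
  where
  lemma : ∀ u v → u ℤ.+ v ≡ u ℤ.* + 1 ℤ.+ v ℤ.* + 1 ℤ.+ (+ 0 ℤ.- + 0)
  lemma = ℤ-Solver.solve-∀
run-value {c@(config u v _ _ _)} {b ∷ w} {s ∷ ss} {c'} (st ∷ rest) with step-just c b s st
... | _ , refl = begin
  Config.u c' ℤ.+ Config.v c'                                             ≡⟨ run-value rest ⟩
  (u ℤ.+ v ℤ.+ B ℤ.- S ℤ.- S) ℤ.* (y ℤ.+ x) ℤ.+ (u ℤ.+ S) ℤ.* y ℤ.+ (+ zval w ℤ.- + lucasValue ss)
    ≡⟨ lemma u v B S x y (+ zval w) (+ lucasValue ss) ⟩
  u ℤ.* ((y ℤ.+ x) ℤ.+ y) ℤ.+ v ℤ.* (y ℤ.+ x) ℤ.+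
    ((B ℤ.* (y ℤ.+ x) ℤ.+ + zval w) ℤ.- (S ℤ.* (x ℤ.+ (y ℤ.+ x)) ℤ.+ + lucasValue ss))
    ≡⟨ cong₂ (λ z l → u ℤ.* ((y ℤ.+ x) ℤ.+ y) ℤ.+ v ℤ.* (y ℤ.+ x) ℤ.+ ((z ℤ.+ + zval w) ℤ.- (l ℤ.+ + lucasValue ss)))
             zeckendorf-digit lucas-digit ⟩
  u ℤ.* + fib (3 + length w) ℤ.+ v ℤ.* + fib (2 + length w) ℤ.+ (+ zval (b ∷ w) ℤ.- + lucasValue (s ∷ ss)) ∎
  where
  open ≡-Reasoning
  B S x y : ℤ
  B = bit b
  S = bit s
  x = + fib (length w)
  y = + fib (suc (length w))
  lemma : ∀ u v B S x y Z L →
    (u ℤ.+ v ℤ.+ B ℤ.- S ℤ.- S) ℤ.* (y ℤ.+ x) ℤ.+ (u ℤ.+ S) ℤ.* y ℤ.+ (Z ℤ.- L)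
      ≡ u ℤ.* ((y ℤ.+ x) ℤ.+ y) ℤ.+ v ℤ.* (y ℤ.+ x) ℤ.+ ((B ℤ.* (y ℤ.+ x) ℤ.+ Z) ℤ.- (S ℤ.* (x ℤ.+ (y ℤ.+ x)) ℤ.+ L))
  lemma = ℤ-Solver.solve-∀
  zeckendorf-digit : B ℤ.* (y ℤ.+ x) ≡ + (if b then fib (length w + 2) else 0)
  zeckendorf-digit = trans (cong (λ n → B ℤ.* + fib n) (+-comm 2 (length w))) (sym (bit-* b _))
  lucas-digit : S ℤ.* (x ℤ.+ (y ℤ.+ x)) ≡ + (if s then lucas (suc (length ss)) else 0)
  lucas-digit = trans (cong (λ n → S ℤ.* + n) (sym (trans (cong (lucas ∘ suc) (run-length rest)) (lucas-suc (length w))))) (sym (bit-* s _))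

allowed⇔ : ∀ c b s → T (allowed c b s) ⇔ (T (started c ∨ b) × lastOne c ∧ b ≡ false × evenRest c ∧ s ≡ false)
allowed⇔ c b s = mk⇔
  (λ ok → let (first , rest) = Equivalence.to T-∧ ok ; (adjacent , guess) = Equivalence.to T-∧ rest
          in first , Equivalence.to T-not-≡ adjacent , Equivalence.to T-not-≡ guess)
  (λ (first , adjacent , guess) →
     Equivalence.from T-∧ (first , Equivalence.from T-∧ (Equivalence.from T-not-≡ adjacent , Equivalence.from T-not-≡ guess)))

NoAdjacentOnes-∷ : ∀ l b w → l ∧ b ≡ false → NoAdjacentOnes (b ∷ w) → NoAdjacentOnes (l ∷ b ∷ w)
NoAdjacentOnes-∷ true  true  w ()
NoAdjacentOnes-∷ true  false w _ = id
NoAdjacentOnes-∷ false b     w _ = id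

NoAdjacentOnes-∷⁻ : ∀ l b w → NoAdjacentOnes (l ∷ b ∷ w) → l ∧ b ≡ false × NoAdjacentOnes (b ∷ w)
NoAdjacentOnes-∷⁻ true  true  w ()
NoAdjacentOnes-∷⁻ true  false w na = refl , na
NoAdjacentOnes-∷⁻ false b     w na = refl , na

NoAdjacentOnes-false∷ : ∀ w → NoAdjacentOnes (false ∷ w) ⇔ NoAdjacentOnes w
NoAdjacentOnes-false∷ []      = mk⇔ id id
NoAdjacentOnes-false∷ (_ ∷ _) = mk⇔ id id

guess⇒even : ∀ n {e s} → e ≡ evenℕ (suc n) → e ∧ s ≡ false → T s → T (evenℕ n)
guess⇒even n {s = false} _  _   ()
guess⇒even n {s = true}  e≡ e∧s _ rewrite evenℕ-suc n with evenℕ n | e≡ | e∧s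
... | true  | _    | _  = tt
... | false | refl | ()

even⇒guess : ∀ n {e s} → e ≡ evenℕ (suc n) → (T s → T (evenℕ n)) → e ∧ s ≡ false
even⇒guess n {e} {false} _  _    = ∧-zeroʳ e
even⇒guess n {e} {true}  e≡ at-even rewrite e≡ | evenℕ-suc n with evenℕ n | at-even tt
... | true  | _  = refl
... | false | ()

NoLeadingZero⇒T-∨ : ∀ {x} b w → (x ≡ false → NoLeadingZero (b ∷ w)) → T (x ∨ b)
NoLeadingZero⇒T-∨ {true}  b     w _  = tt
NoLeadingZero⇒T-∨ {false} true  w _  = tt
NoLeadingZero⇒T-∨ {false} false w nl = nl refl

T-∨⇒NoLeadingZero : ∀ {x} b w → x ≡ false → T (x ∨ b) → NoLeadingZero (b ∷ w)
T-∨⇒NoLeadingZero true w _    _ = tt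
T-∨⇒NoLeadingZero false w refl ()

run-flags : ∀ {c w ss c'} → Run step c w ss c' → T (evenRest c') →
            evenRest c ≡ evenℕ (length w) × NoAdjacentOnes (lastOne c ∷ w) × EvenOnly ss
run-flags {config _ _ true  _ _} [] _  = refl , tt , tt
run-flags {config _ _ false _ _} [] ()
run-flags {c} {b ∷ w} {s ∷ ss} (st ∷ rest) final with step-just c b s st
... | ok , refl with run-flags rest final | Equivalence.to (allowed⇔ c b s) ok
... | parity , adjacent , even-only | _ , no-adjacent , no-odd-guess =
  parity′ , NoAdjacentOnes-∷ (lastOne c) b w no-adjacent adjacent ,
  subst (λ n → T s → T (evenℕ n)) (sym (run-length rest)) (guess⇒even (length w) parity′ no-odd-guess) , even-only
  where
  parity′ : evenRest c ≡ evenℕ (suc (length w))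
  parity′ = trans (sym (not-involutive _)) (trans (cong not parity) (sym (evenℕ-suc (length w))))

run-leading : ∀ {c w ss c'} → Run step c w ss c' → started c ≡ false → NoLeadingZero w
run-leading []                                      _           = tt
run-leading {c} {b ∷ w} {s ∷ ss} (st ∷ _) not-started with step-just c b s st
... | ok , _ = T-∨⇒NoLeadingZero b w not-started (proj₁ (Equivalence.to (allowed⇔ c b s) ok))

run-exists : ∀ c w ss → evenRest c ≡ evenℕ (length w) → NoAdjacentOnes (lastOne c ∷ w) → (started c ≡ false → NoLeadingZero w) →
             EvenOnly ss → length ss ≡ length w → ∃[ c' ] (Run step c w ss c' × T (evenRest c'))
run-exists c [] [] parity _ _ _ _ = c , [] , subst T (sym parity) tt
run-exists c (b ∷ w) (s ∷ ss) parity adjacent leading (guess , even-only) length≡ =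
  let (c' , rest , final) = run-exists (advance c b s) w ss parity′ no-adjacent′ (λ ()) even-only (suc-injective length≡)
  in c' , step-allowed {c} {b} {s} ok ∷ rest , final
  where
  parity′ : not (evenRest c) ≡ evenℕ (length w)
  parity′ = trans (cong not parity) (not-evenℕ-suc (length w))
  no-adjacent′ : NoAdjacentOnes (b ∷ w)
  no-adjacent′ = proj₂ (NoAdjacentOnes-∷⁻ (lastOne c) b w adjacent)
  ok : T (allowed c b s)
  ok = Equivalence.from (allowed⇔ c b s)
    ( NoLeadingZero⇒T-∨ b w leading
    , proj₁ (NoAdjacentOnes-∷⁻ (lastOne c) b w adjacent)
    , even⇒guess (length w) parity (subst (λ n → T s → T (evenℕ n)) (suc-injective length≡) guess))

private
  new-u : ∀ u v B S → u ℤ.+ v ℤ.+ B ℤ.- S ℤ.- S ≡ (u ℤ.+ v) ℤ.+ (B ℤ.- S ℤ.- S)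
  new-u = ℤ-Solver.solve-∀

  new-sum : ∀ u v B S → (u ℤ.+ v ℤ.+ B ℤ.- S ℤ.- S) ℤ.+ (u ℤ.+ S) ≡ ((u ℤ.+ v) ℤ.+ u) ℤ.+ (B ℤ.- S)
  new-sum = ℤ-Solver.solve-∀

  digit-bounds : ∀ b s → let B = bit b ; S = bit s in
    -[1+ 1 ] ℤ.≤ B ℤ.- S ℤ.- S × B ℤ.- S ℤ.- S ℤ.≤ + 1 × -[1+ 0 ] ℤ.≤ B ℤ.- S × B ℤ.- S ℤ.≤ + 1
  digit-bounds false false = ℤ.-≤+ , ℤ.+≤+ z≤n , ℤ.-≤+ , ℤ.+≤+ z≤n
  digit-bounds false true  = ℤ.≤-refl , ℤ.-≤+ , ℤ.≤-refl , ℤ.-≤+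
  digit-bounds true  false = ℤ.-≤+ , ℤ.≤-refl , ℤ.-≤+ , ℤ.≤-refl
  digit-bounds true  true  = ℤ.-≤- z≤n , ℤ.-≤+ , ℤ.-≤+ , ℤ.+≤+ z≤n

dead-advance : ∀ c b s → Dead c → Dead (advance c b s)
dead-advance (config u v _ _ _) b s (inj₁ (1≤u , 3≤u+v)) = inj₁
  ( subst (+ 1 ℤ.≤_) (sym (new-u u v (bit b) (bit s))) (ℤ.+-mono-≤ 3≤u+v (proj₁ (digit-bounds b s)))
  , subst (+ 3 ℤ.≤_) (sym (new-sum u v (bit b) (bit s)))
          (ℤ.+-mono-≤ (ℤ.+-mono-≤ 3≤u+v 1≤u) (proj₁ (proj₂ (proj₂ (digit-bounds b s))))) )
dead-advance (config u v _ _ _) b s (inj₂ (u≤-1 , u+v≤-2)) = inj₂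
  ( subst (ℤ._≤ -[1+ 0 ]) (sym (new-u u v (bit b) (bit s))) (ℤ.+-mono-≤ u+v≤-2 (proj₁ (proj₂ (digit-bounds b s))))
  , subst (ℤ._≤ -[1+ 1 ]) (sym (new-sum u v (bit b) (bit s)))
          (ℤ.+-mono-≤ (ℤ.+-mono-≤ u+v≤-2 u≤-1) (proj₂ (proj₂ (proj₂ (digit-bounds b s))))) )

dead-step : ∀ {c b s c'} → Dead c → step c b s ≡ just c' → Dead c'
dead-step {c} {b} {s} dead st with step-just c b s st
... | _ , refl = dead-advance c b s dead

dead⇒rejecting : ∀ {c} → Dead c → ¬ Accepting c
dead⇒rejecting (inj₁ (_ , 3≤u+v)) (_ , u+v≡1) with subst (+ 3 ℤ.≤_) u+v≡1 3≤u+v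
... | ℤ.+≤+ (s≤s ())
dead⇒rejecting (inj₂ (_ , u+v≤-2)) (_ , u+v≡1) with subst (ℤ._≤ -[1+ 1 ]) u+v≡1 u+v≤-2
... | ()

dead? : Decidable Dead
dead? c = (+ 1 ℤ.≤? u c ×-dec + 3 ℤ.≤? u c ℤ.+ v c) ⊎-dec (u c ℤ.≤? -[1+ 0 ] ×-dec u c ℤ.+ v c ℤ.≤? -[1+ 1 ])

accepting? : Decidable Accepting
accepting? c = T? (evenRest c) ×-dec (u c ℤ.+ v c ℤ.≟ + 1)

_≟ᶜ_ : DecidableEquality Config
c ≟ᶜ c' = map′ (cong fromTuple) (cong toTuple)
  (≡-dec ℤ._≟_ (≡-dec ℤ._≟_ (≡-dec Bool._≟_ (≡-dec Bool._≟_ Bool._≟_))) (toTuple c) (toTuple c'))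
  where
  toTuple : Config → ℤ × ℤ × Bool × Bool × Bool
  toTuple (config u v e l s) = u , v , e , l , s
  fromTuple : ℤ × ℤ × Bool × Bool × Bool → Config
  fromTuple (u , v , e , l , s) = config u v e l s

open Determinisation _≟ᶜ_ step dead? (λ {c} {b} {s} → dead-step {c} {b} {s}) accepting? (λ {c} → dead⇒rejecting {c})

initials : List Config
initials = initial false ∷ initial true ∷ []

-- Ten rounds of exploration find all 42 reachable subsets.  Abstract, as otherwise the type
-- checker would rerun the exploration whenever it normalises a type mentioning dfa.
abstract
  explored : List (List Config)
  explored = drop 1 (explore 10 (initials ∷ []))

  certified : Table.Certified initials explored
  certified = from-yes (Table.certified? initials explored)

open Table initials explored

initial-run-value : ∀ {p w ss c'} → Run step (initial p) w ss c' → u c' ℤ.+ v c' ≡ + zval w ℤ.- + lucasValue ss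
initial-run-value {w = w} {ss} run =
  trans (run-value run) (lemma (+ fib (suc (suc (length w)))) (+ fib (suc (length w))) (+ zval w ℤ.- + lucasValue ss))
  where
  lemma : ∀ x y z → + 0 ℤ.* x ℤ.+ + 0 ℤ.* y ℤ.+ z ≡ z
  lemma = ℤ-Solver.solve-∀

difference≡1⇔ : ∀ z l → + z ℤ.- + l ≡ + 1 ⇔ z ≡ suc l
difference≡1⇔ z l = mk⇔
  (λ eq → ℤ.+-injective (trans (sym (cancel (+ z) (+ l))) (cong (ℤ._+ + l) eq)))
  (λ { refl → cancel′ (+ l) })
  where
  cancel : ∀ z l → (z ℤ.- l) ℤ.+ l ≡ z
  cancel = ℤ-Solver.solve-∀
  cancel′ : ∀ l → (+ 1 ℤ.+ l) ℤ.- l ≡ + 1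
  cancel′ = ℤ-Solver.solve-∀

run-sound : ∀ {p w ss c'} → Run step (initial p) w ss c' → Accepting c' →
            NoLeadingZero w × NoAdjacentOnes w × EvenOnly ss × zval w ≡ suc (lucasValue ss)
run-sound {w = w} {ss} run (final , u+v≡1) =
  let (_ , no-adjacent , even-only) = run-flags run final
  in run-leading run refl , Equivalence.to (NoAdjacentOnes-false∷ w) no-adjacent , even-only ,
     Equivalence.to (difference≡1⇔ (zval w) (lucasValue ss)) (trans (sym (initial-run-value run)) u+v≡1)

run-complete : ∀ {w ss} → NoLeadingZero w → NoAdjacentOnes w → EvenOnly ss → length ss ≡ length w →
               zval w ≡ suc (lucasValue ss) → ∃[ c' ] (Run step (initial (evenℕ (length w))) w ss c' × Accepting c')
run-complete {w} {ss} no-leading no-adjacent even-only length≡ zval≡ =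
  let (c' , run , final) = run-exists (initial (evenℕ (length w))) w ss refl (Equivalence.from (NoAdjacentOnes-false∷ w) no-adjacent)
                                      (λ _ → no-leading) even-only length≡
  in c' , run , final , trans (initial-run-value run) (Equivalence.from (difference≡1⇔ (zval w) (lucasValue ss)) zval≡)

lucasIndices : List Bool → List ℕ
lucasIndices []       = []
lucasIndices (s ∷ ss) = if s then ⌊ length ss /2⌋ ∷ lucasIndices ss else lucasIndices ss

lucasIndices-bound : ∀ ss → All (λ i → 2 * i < length ss) (lucasIndices ss)
lucasIndices-bound []           = []
lucasIndices-bound (false ∷ ss) = All.map m<n⇒m<1+n (lucasIndices-bound ss)
lucasIndices-bound (true ∷ ss)  = s≤s (2*⌊n/2⌋≤n (length ss)) ∷ All.map m<n⇒m<1+n (lucasIndices-bound ss)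

lucasIndices-unique : ∀ ss → EvenOnly ss → Unique (lucasIndices ss)
lucasIndices-unique []           _                    = []
lucasIndices-unique (false ∷ ss) (_ , even-only)      = lucasIndices-unique ss even-only
lucasIndices-unique (true ∷ ss)  (at-even , even-only) =
  All.map (λ 2i<n h≡i → <-irrefl (trans (sym (cong (2 *_) h≡i)) (even⇒2*⌊n/2⌋≡n (length ss) (at-even tt))) 2i<n)
    (lucasIndices-bound ss)
  ∷ lucasIndices-unique ss even-only

lucasValue≡sum-oddLucas : ∀ ss → EvenOnly ss → lucasValue ss ≡ sum (map oddLucas (lucasIndices ss))
lucasValue≡sum-oddLucas []           _                     = refl
lucasValue≡sum-oddLucas (false ∷ ss) (_ , even-only)       = lucasValue≡sum-oddLucas ss even-only
lucasValue≡sum-oddLucas (true ∷ ss)  (at-even , even-only) =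
  cong₂ _+_ (cong (lucas ∘ suc) (sym (even⇒2*⌊n/2⌋≡n (length ss) (at-even tt)))) (lucasValue≡sum-oddLucas ss even-only)

indicatorWord : List ℕ → ℕ → List Bool
indicatorWord D zero    = []
indicatorWord D (suc k) = (k ∈ᵇ D) ∷ indicatorWord D k

length-indicatorWord : ∀ D k → length (indicatorWord D k) ≡ k
length-indicatorWord D zero    = refl
length-indicatorWord D (suc k) = cong suc (length-indicatorWord D k)

lucasValue-indicatorWord : ∀ D k → lucasValue (indicatorWord D k) ≡ ∑[ j < k ] 𝟙 (j ∈ᵇ D) * lucas (suc j)
lucasValue-indicatorWord D zero    = refl
lucasValue-indicatorWord D (suc k) rewrite length-indicatorWord D k | lucasValue-indicatorWord D k =
  trans (cong (_+ ∑[ j < k ] 𝟙 (j ∈ᵇ D) * lucas (suc j)) (if≡𝟙* (k ∈ᵇ D) _)) (+-comm (𝟙 (k ∈ᵇ D) * lucas (suc k)) _)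

indicatorWord-even : ∀ D k → All (T ∘ evenℕ) D → EvenOnly (indicatorWord D k)
indicatorWord-even D zero    _    = tt
indicatorWord-even D (suc k) D-even = at-even , indicatorWord-even D k D-even
  where
  at-even : T (k ∈ᵇ D) → T (evenℕ (length (indicatorWord D k)))
  at-even with k ∈? D
  ... | yes k∈D = λ _ → subst (T ∘ evenℕ) (sym (length-indicatorWord D k)) (All.lookup D-even k∈D)
  ... | no _    = λ ()

lucasWord : ∀ {S k} → Unique S → All (λ i → 2 * i < k) S →
            ∃[ ss ] (length ss ≡ k × EvenOnly ss × lucasValue ss ≡ sum (map oddLucas S))
lucasWord {S} {k} unique bounded =
  indicatorWord D k , length-indicatorWord D k , indicatorWord-even D k D-even , (begin
    lucasValue (indicatorWord D k)               ≡⟨ lucasValue-indicatorWord D k ⟩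
    ∑[ j < k ] 𝟙 (j ∈ᵇ D) * lucas (suc j)         ≡⟨ sym (sum-map≡∑𝟙∈ᵇ k (lucas ∘ suc) D-unique (All.map⁺ bounded)) ⟩
    sum (map (lucas ∘ suc) D)                    ≡⟨ cong sum (sym (map-∘ S)) ⟩
    sum (map oddLucas S)                         ∎)
  where
  open ≡-Reasoning
  D : List ℕ
  D = map (2 *_) S
  D-unique : Unique D
  D-unique = Unique.map⁺ (*-cancelˡ-≡ _ _ 2) unique
  D-even : All (T ∘ evenℕ) D
  D-even = All.map⁺ (All.tabulate (λ {i} _ → subst T (sym (evenℕ-2* i)) tt))

zval-bound : ∀ w → NoAdjacentOnes w → zval w < fib (suc (suc (length w)))
zval-bound []               _  = s≤s z≤n
zval-bound (false ∷ w)      na = ≤-trans (zval-bound w (Equivalence.to (NoAdjacentOnes-false∷ w) na)) (fib-≤-suc (suc (suc (length w))))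
zval-bound (true ∷ [])      _  = s≤s (s≤s z≤n)
zval-bound (true ∷ false ∷ w) na = begin-strict
  fib (suc (length w) + 2) + zval w                     ≡⟨ cong (λ n → fib n + zval w) (+-comm (suc (length w)) 2) ⟩
  fib (suc (suc (suc (length w)))) + zval w             <⟨ +-monoʳ-< _ (zval-bound w (Equivalence.to (NoAdjacentOnes-false∷ w) na)) ⟩
  fib (suc (suc (suc (length w)))) + fib (suc (suc (length w))) ∎
  where open ≤-Reasoning

oddLucas-index-bound : ∀ {w S} → NoAdjacentOnes w → zval w ≡ suc (sum (map oddLucas S)) → All (λ i → 2 * i < length w) S
oddLucas-index-bound {w} {S} no-adjacent zval≡ = All.map (λ {i} → index-bound {i}) (All.map⁻ (sum-bounds (map oddLucas S)))
  where
  index-bound : ∀ {i} → oddLucas i ≤ sum (map oddLucas S) → 2 * i < length w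
  index-bound {i} L≤ with 2 * i <? length w
  ... | yes 2i<|w| = 2i<|w|
  ... | no 2i≮|w| = ⊥-elim (<-irrefl refl (begin-strict
    fib (suc (suc (length w)))      ≤⟨ fib-mono-≤ (s≤s (s≤s (≮⇒≥ 2i≮|w|))) ⟩
    fib (suc (suc (2 * i)))         ≤⟨ m≤n+m _ (fib (2 * i)) ⟩
    fib (2 * i) + fib (suc (suc (2 * i))) ≡⟨ sym (lucas-suc (2 * i)) ⟩
    oddLucas i                      ≤⟨ L≤ ⟩
    sum (map oddLucas S)            <⟨ n<1+n _ ⟩
    suc (sum (map oddLucas S))      ≡⟨ sym zval≡ ⟩
    zval w                          <⟨ zval-bound w no-adjacent ⟩
    fib (suc (suc (length w)))      ∎))
    where open ≤-Reasoning

initial∈initials : ∀ p → initial p ∈ initials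
initial∈initials false = here refl
initial∈initials true  = there (here refl)

∈-initials : ∀ {c} → c ∈ initials → ∃[ p ] c ≡ initial p
∈-initials (here refl)         = false , refl
∈-initials (there (here refl)) = true , refl

accepts⇔Zeckendorf-InT : ∀ w → accepts dfa w ≡ true ⇔ (∃[ n ] (InT n × IsZeckendorf w n))
accepts⇔Zeckendorf-InT w = mk⇔ to from
  where
  to : accepts dfa w ≡ true → ∃[ n ] (InT n × IsZeckendorf w n)
  to acc with Equivalence.to (accepts⇔ certified w) acc
  ... | c , ss , c' , c∈ , run , accepting with ∈-initials c∈
  ... | p , refl with run-sound run accepting
  ... | no-leading , no-adjacent , even-only , zval≡ =
    zval w , subst InT (sym (trans zval≡ (cong suc (lucasValue≡sum-oddLucas ss even-only))))
                       (InT-suc-sum-oddLucas (lucasIndices-unique ss even-only))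
           , no-leading , no-adjacent , refl
  from : ∃[ n ] (InT n × IsZeckendorf w n) → accepts dfa w ≡ true
  from (n , inT , no-leading , no-adjacent , refl) with InT⇒suc-sum-oddLucas inT
  ... | S , unique , zval≡ with lucasWord unique (oddLucas-index-bound {w} no-adjacent zval≡)
  ... | ss , length≡ , even-only , lucasValue≡
    with run-complete {w} no-leading no-adjacent even-only length≡ (trans zval≡ (cong suc (sym lucasValue≡)))
  ... | c' , run , accepting = Equivalence.from (accepts⇔ certified w) (_ , ss , c' , initial∈initials _ , run , accepting)

theorem7 : (Σ DFA λ D → (w : List Bool) →
              (accepts D w ≡ true) ⇔ (∃[ n ] (InT n × IsZeckendorf w n)))
         × ((n : ℕ) → 1 ≤ n →
              InT n ⇔ (∃[ S ] (Unique S × (n ∸ 1 ≡ sum (map oddLucas S)))))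
theorem7 = (dfa , accepts⇔Zeckendorf-InT) , λ { (suc n) _ → InT⇔oddLucas n }
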